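{- Let $B$ be a block of length $n$, written as a concatenation $B=B_1B_2$ of two nonempty blocks, and let $b$ be the number of $1$'s in $B_2$. Then for all integers $i,j\ge0$, $$p(B)^i_j=\sum_{a=1}^{b+i+1}p(B_1)^{a-1}_j\;p(B_2)^i_a.$$
   Context: A block of length $m$ is a $0/1$ array of length $m$; $P_B$ denotes the set of indices (in $\{1,\ldots,m\}$) where $B$ has a $1$. For a word $w=w_1\cdots w_L$ of integers (repetitions allowed), a pinnacle is an entry $w_t$ with $1<t<L$ and $w_{t-1}<w_t>w_{t+1}$ (strict), and the pinnacle multiset is the multiset of values of its pinnacles; an entry $w_t$ is a cyclic vale if $w_{t-1}>w_t<w_{t+1}$ where we set $w_0=w_{L+1}=+\infty$ (equivalently, a vale of the cyclic word obtained by prepending $\infty$ and wrapping around). For a block $B$ of length $m$ and integers $i,j\ge0$, $P(B)^i_j$ is the set of all words that are arrangements of the multiset $\{1,2,\ldots,m\}\cup\{0^j\}\cup\{(m+1)^i\}$ (i.e., $j$ copies of $0$ and $i$ copies of $m+1$) whose pinnacle multiset is exactly $P_B\cup\{(m+1)^i\}$ and in which every copy of $0$ is a cyclic vale; $p(B)^i_j=|P(B)^i_j|$. Write $p(B)^i=p(B)^i_0$, $p(B)_j=p(B)^0_j$, $p(B)=p(B)^0_0$ (the number of $\pi\in S_m$ with pinnacle set $P_B$). -}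

module Defs where

open import Data.Bool using (Bool; true; false; _∧_; if_then_else_)
open import Data.Nat using (ℕ; zero; suc; _+_; _*_; _∸_; _≡ᵇ_; _<ᵇ_)
open import Data.List using (List; []; _∷_; _++_; length; filter; map; concatMap; upTo; applyUpTo; [_])
open import Data.Bool.ListAction using (all)
open import Data.Nat.ListAction using (sum)
open import Data.Maybe using (Maybe; just; nothing)
open import Relation.Nullary using (Dec; yes; no)
open import Relation.Binary.PropositionalEquality using (_≡_; refl)

-- A block is a 0/1 array (true = 1); its length is m.
Block : Set
Block = List Bool

ones : Block → ℕ
ones [] = 0
ones (true ∷ B) = suc (ones B)
ones (false ∷ B) = ones B

-- bitAt B v = true  iff  v ∈ P_B  (positions are 1-based: 1 ≤ v ≤ m)
bitAt : Block → ℕ → Bool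
bitAt [] _ = false
bitAt (x ∷ B) zero = false
bitAt (x ∷ B) (suc zero) = x
bitAt (x ∷ B) (suc (suc v)) = bitAt B (suc v)

countOcc : ℕ → List ℕ → ℕ
countOcc v w = length (filter (λ x → x Data.Nat.≟ v) w)

pinnacles : List ℕ → List ℕ
pinnacles (x ∷ y ∷ z ∷ rest) =
  if (x <ᵇ y) ∧ (z <ᵇ y) then y ∷ pinnacles (y ∷ z ∷ rest) else pinnacles (y ∷ z ∷ rest)
pinnacles _ = []

-- extended values: nothing = +∞
_<∞_ : ℕ → Maybe ℕ → Bool
c <∞ nothing = true
c <∞ just x = c <ᵇ x

-- w_t (with neighbours l, r; +∞ at the ends) is a cyclic vale
isCyclicVale : Maybe ℕ → ℕ → Maybe ℕ → Bool
isCyclicVale l c r = (c <∞ l) ∧ (c <∞ r)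

zerosValesFrom : Maybe ℕ → List ℕ → Bool
zerosValesFrom l [] = true
zerosValesFrom l (c ∷ []) = (if c ≡ᵇ 0 then isCyclicVale l c nothing else true)
zerosValesFrom l (c ∷ d ∷ rest) =
  (if c ≡ᵇ 0 then isCyclicVale l c (just d) else true) ∧ zerosValesFrom (just c) (d ∷ rest)

allZerosCyclicVales : List ℕ → Bool
allZerosCyclicVales w = zerosValesFrom nothing w

words : ℕ → ℕ → List (List ℕ)
words k zero = [ [] ]
words k (suc L) = concatMap (λ x → map (x ∷_) (words k L)) (upTo k)

multArr : ℕ → ℕ → ℕ → ℕ → ℕ
multArr m i j v = if v ≡ᵇ 0 then j else (if v ≡ᵇ suc m then i else 1)

multPin : Block → ℕ → ℕ → ℕ
multPin B i v = if v ≡ᵇ suc (length B) then i else (if bitAt B v then 1 else 0)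

isArrangement : ℕ → ℕ → ℕ → List ℕ → Bool
isArrangement m i j w = all (λ v → countOcc v w ≡ᵇ multArr m i j v) (upTo (suc (suc m)))

-- pinnacle multiset of w equals P_B ∪ {(m+1)^i}
-- (all pinnacle values lie in {0..m+1} since all entries of w do)
pinnacleOK : Block → ℕ → List ℕ → Bool
pinnacleOK B i w = all (λ v → countOcc v (pinnacles w) ≡ᵇ multPin B i v) (upTo (suc (suc (length B))))

inP : Block → ℕ → ℕ → List ℕ → Bool
inP B i j w = isArrangement (length B) i j w ∧ pinnacleOK B i w ∧ allZerosCyclicVales w

p : Block → ℕ → ℕ → ℕ
p B i j = length (filter (λ w → inP B i j w Data.Bool.≟ true)
                         (words (suc (suc (length B))) (length B + i + j)))

sumFrom1 : ℕ → (ℕ → ℕ) → ℕ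
sumFrom1 N f = sum (map f (applyUpTo suc N))

module Submission where

-- Let k = |B₁|. An admissible word w for B₁B₂ splits into maximal runs of low letters (≤ k)
-- and high letters (> k), w = h₀ l₁ h₁ ⋯ l_r h_r. Joining the low runs with k+1 gives a word u
-- for B₁ with r−1 copies of k+1, and joining the high runs, shifted down by k, with 0 gives a
-- word v for B₂ with r zeros. Being a pinnacle or a cyclic vale is a condition on windows of
-- length three, and once the runs of the other kind are collapsed to single separators, the
-- windows centred at low letters are the same in w and u, those centred at high letters the same
-- in w and v. Hence w ↦ (u, v) is a bijection onto the pairs counted by p(B₁)^{r−1}_j p(B₂)^i_r:
-- requiring k+1 to be a pinnacle in u and 0 a cyclic vale in v is exactly what makes the low runs
-- and the inner high runs nonempty. Finally r ≤ b + i + 1, because consecutive zeros of v are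
-- separated by a peak and v has b + i pinnacles.

open import Defs
open import Data.Bool using (Bool; true; false; _∧_; not; if_then_else_; T)
open import Data.Bool.ListAction using (all)
open import Data.Bool.Properties using (∧-zeroʳ; ∧-identityʳ; not-involutive; ⇔→≡)
open import Data.Empty using (⊥; ⊥-elim)
open import Data.List using (List; []; _∷_; _++_; length; filter; map; concatMap; upTo; applyUpTo; [_]; cartesianProduct; zip)
open import Data.List.Properties using (length-map; length-++; ++-identityʳ; ∷-injective; ∷-injectiveˡ; ∷-injectiveʳ; map-++; map-∘; ++-assoc)
open import Data.List.Membership.Propositional using (_∈_; find; lose)
open import Data.List.Membership.Propositional.Properties
open import Data.List.Relation.Unary.All as All using (All; []; _∷_)
import Data.List.Relation.Unary.All.Properties as AllP
open import Data.List.Relation.Unary.Any using (here; there)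
open import Data.List.Relation.Unary.AllPairs using ([]; _∷_)
open import Data.List.Relation.Unary.Unique.Propositional using (Unique)
import Data.List.Relation.Unary.Unique.Propositional.Properties as UP
open import Data.Maybe using (Maybe; just; nothing)
open import Data.Nat using (ℕ; zero; suc; _+_; _*_; _∸_; _≡ᵇ_; _<ᵇ_; _<_; _≤_; z≤n; s≤s; _≟_; _<?_)
open import Data.Nat.ListAction using (sum)
open import Data.Nat.Properties
open import Algebra.Properties.CommutativeSemigroup +-commutativeSemigroup using (interchange)
open import Data.Product using (_×_; _,_; proj₁; proj₂; Σ)
open import Data.Sum using (_⊎_; inj₁; inj₂)
open import Data.Unit using (⊤; tt)
open import Function.Bundles using (mk⇔)
open import Relation.Binary.Definitions using (Tri; tri<; tri≈; tri>)
open import Relation.Binary.PropositionalEquality hiding ([_])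
open import Relation.Nullary using (Dec; yes; no; does; ¬_)
open import Relation.Nullary.Decidable using (T?)
open import Relation.Unary using (Decidable)

T⇒≡true : ∀ {b} → T b → b ≡ true
T⇒≡true {true} _ = refl

≡true⇒T : ∀ {b} → b ≡ true → T b
≡true⇒T refl = tt

truth-ext : {b₁ b₂ : Bool} → (b₁ ≡ true → b₂ ≡ true) → (b₂ ≡ true → b₁ ≡ true) → b₁ ≡ b₂
truth-ext f g = ⇔→≡ {z = true} (mk⇔ f g)

<ᵇ-true : ∀ {m n} → m < n → (m <ᵇ n) ≡ true
<ᵇ-true p = T⇒≡true (<⇒<ᵇ p)

<ᵇ-true⁻ : ∀ {m n} → (m <ᵇ n) ≡ true → m < n
<ᵇ-true⁻ {m} {n} e = <ᵇ⇒< m n (≡true⇒T e)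

<ᵇ-false : ∀ {m n} → n ≤ m → (m <ᵇ n) ≡ false
<ᵇ-false {m} {n} p with m <ᵇ n in eq
... | true = ⊥-elim (<⇒≱ (<ᵇ-true⁻ eq) p)
... | false = refl

<ᵇ-false⁻ : ∀ {m n} → (m <ᵇ n) ≡ false → n ≤ m
<ᵇ-false⁻ {m} {n} e with m <? n
... | yes p = ⊥-elim (subst (λ b → b ≡ false → ⊥) (sym (<ᵇ-true p)) (λ ()) e)
... | no np = ≮⇒≥ np

≡ᵇ-true : ∀ {m n} → m ≡ n → (m ≡ᵇ n) ≡ true
≡ᵇ-true {m} {n} p = T⇒≡true (≡⇒≡ᵇ m n p)

≡ᵇ-true⁻ : ∀ {m n} → (m ≡ᵇ n) ≡ true → m ≡ n
≡ᵇ-true⁻ {m} {n} e = ≡ᵇ⇒≡ m n (≡true⇒T e)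

≡ᵇ-false : ∀ {m n} → m ≢ n → (m ≡ᵇ n) ≡ false
≡ᵇ-false {m} {n} p with m ≡ᵇ n in eq
... | true = ⊥-elim (p (≡ᵇ-true⁻ eq))
... | false = refl

≡ᵇ-false⁻ : ∀ {m n} → (m ≡ᵇ n) ≡ false → m ≢ n
≡ᵇ-false⁻ {m} {n} e refl = subst (λ b → b ≡ false → ⊥) (sym (≡ᵇ-true {m} refl)) (λ ()) e

toℕ : Bool → ℕ
toℕ b = if b then 1 else 0

countᵇ : {A : Set} → (A → Bool) → List A → ℕ
countᵇ p [] = 0
countᵇ p (x ∷ xs) = toℕ (p x) + countᵇ p xs

countᵇ-++ : {A : Set} (p : A → Bool) (xs ys : List A) → countᵇ p (xs ++ ys) ≡ countᵇ p xs + countᵇ p ys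
countᵇ-++ p [] ys = refl
countᵇ-++ p (x ∷ xs) ys = trans (cong (toℕ (p x) +_) (countᵇ-++ p xs ys)) (sym (+-assoc (toℕ (p x)) _ _))

countᵇ-map : {A B : Set} (p : B → Bool) (f : A → B) (xs : List A) → countᵇ p (map f xs) ≡ countᵇ (λ x → p (f x)) xs
countᵇ-map p f [] = refl
countᵇ-map p f (x ∷ xs) = cong (toℕ (p (f x)) +_) (countᵇ-map p f xs)

countᵇ-cong : {A : Set} (p q : A → Bool) (xs : List A) → (∀ x → p x ≡ q x) → countᵇ p xs ≡ countᵇ q xs
countᵇ-cong p q [] e = refl
countᵇ-cong p q (x ∷ xs) e = cong₂ _+_ (cong toℕ (e x)) (countᵇ-cong p q xs e)

length-filter≡countᵇ : {A : Set} {P : A → Set} (P? : Decidable P) (xs : List A) →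
  length (filter P? xs) ≡ countᵇ (λ x → does (P? x)) xs
length-filter≡countᵇ P? [] = refl
length-filter≡countᵇ P? (x ∷ xs) with does (P? x)
... | true = cong suc (length-filter≡countᵇ P? xs)
... | false = length-filter≡countᵇ P? xs

sumBelow : ℕ → (ℕ → ℕ) → ℕ
sumBelow zero g = 0
sumBelow (suc n) g = g 0 + sumBelow n (λ c → g (suc c))

sum-map-applyUpTo : (g f : ℕ → ℕ) (n : ℕ) → sum (map g (applyUpTo f n)) ≡ sumBelow n (λ c → g (f c))
sum-map-applyUpTo g f zero = refl
sum-map-applyUpTo g f (suc n) = cong (g (f 0) +_) (sum-map-applyUpTo g (λ c → f (suc c)) n)

sumBelow-cong : (n : ℕ) (g h : ℕ → ℕ) → (∀ c → c < n → g c ≡ h c) → sumBelow n g ≡ sumBelow n h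
sumBelow-cong zero g h e = refl
sumBelow-cong (suc n) g h e = cong₂ _+_ (e 0 (s≤s z≤n)) (sumBelow-cong n _ _ (λ c c<n → e (suc c) (s≤s c<n)))

sumBelow-+ : (n : ℕ) (g h : ℕ → ℕ) → sumBelow n (λ c → g c + h c) ≡ sumBelow n g + sumBelow n h
sumBelow-+ zero g h = refl
sumBelow-+ (suc n) g h = trans (cong (g 0 + h 0 +_) (sumBelow-+ n _ _)) (interchange (g 0) (h 0) _ _)

sumBelow-zero : (n : ℕ) → sumBelow n (λ _ → 0) ≡ 0
sumBelow-zero zero = refl
sumBelow-zero (suc n) = sumBelow-zero n

sumBelow-≡ᵇ : (n c : ℕ) → c < n → sumBelow n (λ a → toℕ (c ≡ᵇ a)) ≡ 1
sumBelow-≡ᵇ (suc n) zero _ = cong suc (trans (sumBelow-cong n _ _ (λ _ _ → refl)) (sumBelow-zero n))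
sumBelow-≡ᵇ (suc n) (suc c) (s≤s c<n) = sumBelow-≡ᵇ n c c<n

all-applyUpTo⁻ : (p : ℕ → Bool) (f : ℕ → ℕ) (n : ℕ) → all p (applyUpTo f n) ≡ true → ∀ c → c < n → p (f c) ≡ true
all-applyUpTo⁻ p f (suc n) e zero _ with p (f 0) | e
... | true | _ = refl
all-applyUpTo⁻ p f (suc n) e (suc c) (s≤s c<n) with p (f 0) | e
... | true | e' = all-applyUpTo⁻ p (λ x → f (suc x)) n e' c c<n

all-applyUpTo⁺ : (p : ℕ → Bool) (f : ℕ → ℕ) (n : ℕ) → (∀ c → c < n → p (f c) ≡ true) → all p (applyUpTo f n) ≡ true
all-applyUpTo⁺ p f zero h = refl
all-applyUpTo⁺ p f (suc n) h rewrite h 0 (s≤s z≤n) = all-applyUpTo⁺ p (λ x → f (suc x)) n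
    (λ c c<n → h (suc c) (s≤s c<n))

length≡sumBelow-countᵇ : {A : Set} (r : A → ℕ) (N : ℕ) (xs : List A) → All (λ x → r x < N) xs →
  length xs ≡ sumBelow N (λ a → countᵇ (λ x → r x ≡ᵇ a) xs)
length≡sumBelow-countᵇ r N [] _ = sym (sumBelow-zero N)
length≡sumBelow-countᵇ r N (x ∷ xs) (rx ∷ h) = begin
    suc (length xs)
        ≡⟨ cong₂ _+_ (sym (sumBelow-≡ᵇ N (r x) rx)) (length≡sumBelow-countᵇ r N xs h) ⟩
    sumBelow N (λ a → toℕ (r x ≡ᵇ a)) + sumBelow N (λ a → countᵇ (λ y → r y ≡ᵇ a) xs) ≡⟨ sym (sumBelow-+ N _ _) ⟩
    sumBelow N (λ a → toℕ (r x ≡ᵇ a) + countᵇ (λ y → r y ≡ᵇ a) xs) ∎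
  where open ≡-Reasoning

length-cartesianProduct : {A B : Set} (xs : List A) (ys : List B) → length (cartesianProduct xs ys)
    ≡ length xs * length ys
length-cartesianProduct [] ys = refl
length-cartesianProduct (x ∷ xs) ys = trans (length-++ (map (x ,_) ys))
    (cong₂ _+_ (length-map (x ,_) ys) (length-cartesianProduct xs ys))

∈-++-remove : {A : Set} {v y : A} (ys1 ys2 : List A) → v ∈ ys1 ++ y ∷ ys2 → v ≢ y → v ∈ ys1 ++ ys2
∈-++-remove [] ys2 (here p) ne = ⊥-elim (ne p)
∈-++-remove [] ys2 (there m) ne = m
∈-++-remove (z ∷ ys1) ys2 (here p) ne = here p
∈-++-remove (z ∷ ys1) ys2 (there m) ne = there (∈-++-remove ys1 ys2 m ne)

length-≤-injection : {A B : Set} (f : A → B) (g : B → A) (xs : List A) (ys : List B) → Unique xs →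
  (∀ {x} → x ∈ xs → f x ∈ ys) → (∀ {x} → x ∈ xs → g (f x) ≡ x) → length xs ≤ length ys
length-≤-injection f g [] ys u h1 h2 = z≤n
length-≤-injection f g (x ∷ xs) ys (ux ∷ u) h1 h2 with ∈-∃++ (h1 (here refl))
... | ys1 , ys2 , refl = begin
      suc (length xs) ≤⟨ s≤s (length-≤-injection f g xs (ys1 ++ ys2) u h1' (λ m → h2 (there m))) ⟩
      suc (length (ys1 ++ ys2)) ≡⟨ cong suc (length-++ ys1) ⟩
      suc (length ys1 + length ys2) ≡⟨ sym (+-suc (length ys1) (length ys2)) ⟩
      length ys1 + suc (length ys2) ≡⟨ sym (length-++ ys1) ⟩
      length (ys1 ++ f x ∷ ys2) ∎
  where
  open ≤-Reasoning
  h1' : ∀ {x'} → x' ∈ xs → f x' ∈ ys1 ++ ys2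
  h1' {x'} m = ∈-++-remove ys1 ys2 (h1 (there m)) λ e →
     All.lookup ux m (trans (sym (h2 (here refl))) (trans (cong g (sym e)) (h2 (there m))))

length-≡-bijection : {A B : Set} (f : A → B) (g : B → A) (xs : List A) (ys : List B) → Unique xs → Unique ys →
  (∀ {x} → x ∈ xs → f x ∈ ys) → (∀ {x} → x ∈ xs → g (f x) ≡ x) →
  (∀ {y} → y ∈ ys → g y ∈ xs) → (∀ {y} → y ∈ ys → f (g y) ≡ y) → length xs ≡ length ys
length-≡-bijection f g xs ys ux uy a b c d = ≤-antisym (length-≤-injection f g xs ys ux a b)
    (length-≤-injection g f ys xs uy c d)

∈-words⁻ : (K L : ℕ) (w : List ℕ) → w ∈ words K L → length w ≡ L × All (_< K) w
∈-words⁻ K zero .[] (here refl) = refl , []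
∈-words⁻ K (suc L) w m with find (∈-concatMap⁻ (λ x → map (x ∷_) (words K L)) {xs = upTo K} m)
... | x , xm , m2 with ∈-map⁻ (x ∷_) m2
...   | w' , m3 , refl with ∈-words⁻ K L w' m3
...     | e , a = cong suc e , ∈-upTo⁻ xm ∷ a

∈-words⁺ : (K L : ℕ) (w : List ℕ) → length w ≡ L → All (_< K) w → w ∈ words K L
∈-words⁺ K zero [] refl _ = here refl
∈-words⁺ K (suc L) (x ∷ w) refl (x<K ∷ a) =
  ∈-concatMap⁺ (λ y → map (y ∷_) (words K L)) {xs = upTo K}
      (lose (∈-upTo⁺ x<K) (∈-map⁺ (x ∷_) (∈-words⁺ K L w refl a)))

map-∷-unique : (x : ℕ) (W : List (List ℕ)) → Unique W → Unique (map (x ∷_) W)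
map-∷-unique x W u = UP.map⁺ (λ { refl → refl }) u

concatMap-∷-unique : (W : List (List ℕ)) (xs : List ℕ) → Unique W → Unique xs →
  Unique (concatMap (λ x → map (x ∷_) W) xs)
concatMap-∷-unique W [] uW ux = []
concatMap-∷-unique W (x ∷ xs) uW (ax ∷ ux) = UP.++⁺ (map-∷-unique x W uW) (concatMap-∷-unique W xs uW ux) disjoint
  where
  disjoint : ∀ {v} → ¬ (v ∈ map (x ∷_) W × v ∈ concatMap (λ x → map (x ∷_) W) xs)
  disjoint (m1 , m2) with ∈-map⁻ (x ∷_) m1 | find (∈-concatMap⁻ (λ x → map (x ∷_) W) {xs = xs} m2)
  ... | w1 , _ , refl | y , ym , m3 with ∈-map⁻ (y ∷_) m3
  ...   | w2 , _ , e = All.lookup ax ym (∷-injectiveˡ e)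

words-unique : (K L : ℕ) → Unique (words K L)
words-unique K zero = [] ∷ []
words-unique K (suc L) = concatMap-∷-unique (words K L) (upTo K) (words-unique K L) (UP.upTo⁺ K)

-- Windows of a framed word

-- Framing w as ∞ w ∞ turns pinnacles and cyclic vales of w into properties of single windows.
data ℕ∞ : Set where
  fin : ℕ → ℕ∞
  ∞ : ℕ∞

_<ᵇ∞_ : ℕ∞ → ℕ∞ → Bool
fin a <ᵇ∞ fin b = a <ᵇ b
fin a <ᵇ∞ ∞ = true
∞ <ᵇ∞ _ = false

isFin : ℕ → ℕ∞ → Bool
isFin c (fin a) = a ≡ᵇ c
isFin c ∞ = false

Triple : Set → Set
Triple A = A × A × A

windows : {A : Set} → List A → List (Triple A)
windows (x ∷ y ∷ z ∷ r) = (x , y , z) ∷ windows (y ∷ z ∷ r)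
windows _ = []

middle : {A : Set} → Triple A → A
middle (_ , y , _) = y

mapTriple : {A B : Set} → (A → B) → Triple A → Triple B
mapTriple f (x , y , z) = (f x , f y , f z)

windows-map : {A B : Set} (f : A → B) (S : List A) → windows (map f S) ≡ map (mapTriple f) (windows S)
windows-map f [] = refl
windows-map f (x ∷ []) = refl
windows-map f (x ∷ y ∷ []) = refl
windows-map f (x ∷ y ∷ z ∷ r) = cong ((f x , f y , f z) ∷_) (windows-map f (y ∷ z ∷ r))

countᵇ-windows-map : {A B : Set} (G : Triple B → Bool) (f : A → B) (S : List A) →
  countᵇ G (windows (map f S)) ≡ countᵇ (λ T → G (mapTriple f T)) (windows S)
countᵇ-windows-map G f S = trans (cong (countᵇ G) (windows-map f S)) (countᵇ-map G (mapTriple f) (windows S))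

isPinnacle : ℕ → Triple ℕ∞ → Bool
isPinnacle c (x , y , z) = isFin c y ∧ ((x <ᵇ∞ y) ∧ (z <ᵇ∞ y))

framedFrom : ℕ∞ → List ℕ → List ℕ∞
framedFrom e v = e ∷ (map fin v ++ [ ∞ ])

nextOr∞ : List ℕ → ℕ∞
nextOr∞ [] = ∞
nextOr∞ (y ∷ _) = fin y

framed : List ℕ → List ℕ∞
framed = framedFrom ∞

pinnacleCount : ℕ → List ℕ → ℕ
pinnacleCount c w = countᵇ (isPinnacle c) (windows (framed w))

occ : ℕ → List ℕ → ℕ
occ c w = countᵇ (λ x → x ≡ᵇ c) w

countOcc≡occ : (c : ℕ) (w : List ℕ) → countOcc c w ≡ occ c w
countOcc≡occ c w = length-filter≡countᵇ (λ x → x ≟ c) w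

occ-pinnacles-∷ : (c x : ℕ) (w : List ℕ) → occ c (pinnacles (x ∷ w))
    ≡ countᵇ (isPinnacle c) (windows (framedFrom (fin x) w))
occ-pinnacles-∷ c x [] = refl
occ-pinnacles-∷ c x (y ∷ []) rewrite ∧-zeroʳ (x <ᵇ y) | ∧-zeroʳ (y ≡ᵇ c) = refl
occ-pinnacles-∷ c x (y ∷ z ∷ r) = trans (ifStep ((x <ᵇ y) ∧ (z <ᵇ y)))
    (cong (toℕ ((y ≡ᵇ c) ∧ ((x <ᵇ y) ∧ (z <ᵇ y))) +_) (occ-pinnacles-∷ c y (z ∷ r)))
  where
  ifStep : (b : Bool) → occ c (if b then y ∷ pinnacles (y ∷ z ∷ r) else pinnacles (y ∷ z ∷ r))
      ≡ toℕ ((y ≡ᵇ c) ∧ b) + occ c (pinnacles (y ∷ z ∷ r))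
  ifStep true = cong (λ q → toℕ q + occ c (pinnacles (y ∷ z ∷ r))) (sym (∧-identityʳ (y ≡ᵇ c)))
  ifStep false = cong (λ q → toℕ q + occ c (pinnacles (y ∷ z ∷ r))) (sym (∧-zeroʳ (y ≡ᵇ c)))

occ-pinnacles : (c : ℕ) (w : List ℕ) → occ c (pinnacles w) ≡ pinnacleCount c w
occ-pinnacles c [] = refl
occ-pinnacles c (x ∷ []) rewrite ∧-zeroʳ (x ≡ᵇ c) = refl
occ-pinnacles c (x ∷ y ∷ w) rewrite ∧-zeroʳ (x ≡ᵇ c) = occ-pinnacles-∷ c x (y ∷ w)

countᵇ-middle : {A : Set} (h : A → Bool) (a b : A) (S : List A)
    → countᵇ (λ T → h (middle T)) (windows (a ∷ (S ++ [ b ]))) ≡ countᵇ h S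
countᵇ-middle h a b [] = refl
countᵇ-middle h a b (s ∷ []) = refl
countᵇ-middle h a b (s ∷ t ∷ S) = cong (toℕ (h s) +_) (countᵇ-middle h s b (t ∷ S))

occ≡countᵇ-middle : (c : ℕ) (w : List ℕ) → occ c w ≡ countᵇ (λ T → isFin c (middle T)) (windows (framed w))
occ≡countᵇ-middle c w = sym (trans (countᵇ-middle (isFin c) ∞ ∞ (map fin w)) (countᵇ-map (isFin c) fin w))

length≡sumBelow-occ : (K : ℕ) (w : List ℕ) → All (_< K) w → length w ≡ sumBelow K (λ c → occ c w)
length≡sumBelow-occ K w a = length≡sumBelow-countᵇ (λ x → x) K w a

toℕ∞ : Maybe ℕ → ℕ∞
toℕ∞ nothing = ∞
toℕ∞ (just x) = fin x

isBadZero : Triple ℕ∞ → Bool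
isBadZero (x , y , z) = isFin 0 y ∧ not ((fin 0 <ᵇ∞ x) ∧ (fin 0 <ᵇ∞ z))

badZeroCount : List ℕ → ℕ
badZeroCount w = countᵇ isBadZero (windows (framed w))

0<∞-toℕ∞ : (l : Maybe ℕ) → (0 <∞ l) ≡ (fin 0 <ᵇ∞ toℕ∞ l)
0<∞-toℕ∞ nothing = refl
0<∞-toℕ∞ (just x) = refl

zeroCheck≡not-isBadZero : (l : Maybe ℕ) (c : ℕ) (r : Maybe ℕ) → (if c ≡ᵇ 0 then isCyclicVale l c r else true)
    ≡ not (isBadZero (toℕ∞ l , fin c , toℕ∞ r))
zeroCheck≡not-isBadZero l zero r rewrite 0<∞-toℕ∞ l | 0<∞-toℕ∞ r = sym (not-involutive _)
zeroCheck≡not-isBadZero l (suc c) r = refl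

toℕ+n≡ᵇ0 : (b : Bool) (n : ℕ) → ((toℕ b + n) ≡ᵇ 0) ≡ not b ∧ (n ≡ᵇ 0)
toℕ+n≡ᵇ0 true n = refl
toℕ+n≡ᵇ0 false n = refl

zerosValesFrom-windows : (l : Maybe ℕ) (w : List ℕ) → zerosValesFrom l w
    ≡ (countᵇ isBadZero (windows (framedFrom (toℕ∞ l) w)) ≡ᵇ 0)
zerosValesFrom-windows l [] = refl
zerosValesFrom-windows l (c ∷ []) = trans (zeroCheck≡not-isBadZero l c nothing)
    (sym (trans (toℕ+n≡ᵇ0 (isBadZero (toℕ∞ l , fin c , ∞)) 0) (∧-identityʳ _)))
zerosValesFrom-windows l (c ∷ d ∷ w) = trans
    (cong₂ _∧_ (zeroCheck≡not-isBadZero l c (just d)) (zerosValesFrom-windows (just c) (d ∷ w)))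
    (sym (toℕ+n≡ᵇ0 (isBadZero (toℕ∞ l , fin c , fin d)) _))

allZerosCyclicVales-windows : (w : List ℕ) → allZerosCyclicVales w ≡ (badZeroCount w ≡ᵇ 0)
allZerosCyclicVales-windows w = zerosValesFrom-windows nothing w

-- Collapsing runs of nothing

mutual
  collapse : {A : Set} → List (Maybe A) → List (Maybe A)
  collapse [] = []
  collapse (just a ∷ r) = just a ∷ collapse r
  collapse (nothing ∷ r) = nothing ∷ collapse′ r

  collapse′ : {A : Set} → List (Maybe A) → List (Maybe A)
  collapse′ [] = []
  collapse′ (nothing ∷ r) = collapse′ r
  collapse′ (just a ∷ r) = just a ∷ collapse r

module Collapse {A : Set} (F : Triple (Maybe A) → Bool) (Fn : ∀ x z → F (x , nothing , z) ≡ false) where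

  firstWindow₂ : Maybe A → Maybe A → List (Maybe A) → ℕ
  firstWindow₂ x y [] = 0
  firstWindow₂ x y (z ∷ _) = toℕ (F (x , y , z))

  firstWindow : Maybe A → List (Maybe A) → ℕ
  firstWindow x [] = 0
  firstWindow x (y ∷ S) = firstWindow₂ x y S

  countᵇ-windows-∷ : (x : Maybe A) (S : List (Maybe A)) → countᵇ F (windows (x ∷ S))
      ≡ firstWindow x S + countᵇ F (windows S)
  countᵇ-windows-∷ x [] = refl
  countᵇ-windows-∷ x (y ∷ []) = refl
  countᵇ-windows-∷ x (y ∷ z ∷ S) = refl

  firstWindow₂-nothing : (x : Maybe A) (S : List (Maybe A)) → firstWindow₂ x nothing S ≡ 0
  firstWindow₂-nothing x [] = refl
  firstWindow₂-nothing x (z ∷ S) rewrite Fn x z = refl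

  firstWindow₂-collapse : (x y : Maybe A) (r : List (Maybe A)) → firstWindow₂ x y (collapse r) ≡ firstWindow₂ x y r
  firstWindow₂-collapse x y [] = refl
  firstWindow₂-collapse x y (just b ∷ r) = refl
  firstWindow₂-collapse x y (nothing ∷ r) = refl

  firstWindow-just-collapse : (x : Maybe A) (a : A) (r : List (Maybe A)) → firstWindow x (just a ∷ collapse r)
      ≡ firstWindow x (just a ∷ r)
  firstWindow-just-collapse x a r = firstWindow₂-collapse x (just a) r

  firstWindow-collapse : (x : Maybe A) (r : List (Maybe A)) → firstWindow x (collapse r) ≡ firstWindow x r
  firstWindow-collapse x [] = refl
  firstWindow-collapse x (just b ∷ r) = firstWindow₂-collapse x (just b) r
  firstWindow-collapse x (nothing ∷ r) = trans (firstWindow₂-nothing x (collapse′ r)) (sym (firstWindow₂-nothing x r))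

  mutual
    countᵇ-windows-collapse : (S : List (Maybe A)) → countᵇ F (windows (collapse S)) ≡ countᵇ F (windows S)
    countᵇ-windows-collapse [] = refl
    countᵇ-windows-collapse (just a ∷ r) = begin
      countᵇ F (windows (just a ∷ collapse r)) ≡⟨ countᵇ-windows-∷ (just a) (collapse r) ⟩
      firstWindow (just a) (collapse r) + countᵇ F (windows (collapse r))
          ≡⟨ cong₂ _+_ (firstWindow-collapse (just a) r) (countᵇ-windows-collapse r) ⟩
      firstWindow (just a) r + countᵇ F (windows r) ≡⟨ sym (countᵇ-windows-∷ (just a) r) ⟩
      countᵇ F (windows (just a ∷ r)) ∎
      where open ≡-Reasoning
    countᵇ-windows-collapse (nothing ∷ r) = countᵇ-windows-collapse′ r

    countᵇ-windows-collapse′ : (S : List (Maybe A)) → countᵇ F (windows (nothing ∷ collapse′ S))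
        ≡ countᵇ F (windows (nothing ∷ S))
    countᵇ-windows-collapse′ [] = refl
    countᵇ-windows-collapse′ (nothing ∷ r) = begin
      countᵇ F (windows (nothing ∷ collapse′ r)) ≡⟨ countᵇ-windows-collapse′ r ⟩
      countᵇ F (windows (nothing ∷ r))
          ≡⟨ cong (_+ countᵇ F (windows (nothing ∷ r))) (sym (firstWindow₂-nothing nothing r)) ⟩
      firstWindow nothing (nothing ∷ r) + countᵇ F (windows (nothing ∷ r))
          ≡⟨ sym (countᵇ-windows-∷ nothing (nothing ∷ r)) ⟩
      countᵇ F (windows (nothing ∷ nothing ∷ r)) ∎
      where open ≡-Reasoning
    countᵇ-windows-collapse′ (just a ∷ r) = begin
      countᵇ F (windows (nothing ∷ just a ∷ collapse r)) ≡⟨ countᵇ-windows-∷ nothing (just a ∷ collapse r) ⟩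
      firstWindow nothing (just a ∷ collapse r) + countᵇ F (windows (just a ∷ collapse r))
          ≡⟨ cong₂ _+_ (firstWindow-just-collapse nothing a r) (countᵇ-windows-collapse (just a ∷ r)) ⟩
      firstWindow nothing (just a ∷ r) + countᵇ F (windows (just a ∷ r))
          ≡⟨ sym (countᵇ-windows-∷ nothing (just a ∷ r)) ⟩
      countᵇ F (windows (nothing ∷ just a ∷ r)) ∎
      where open ≡-Reasoning

AllNothing : {A : Set} → List (Maybe A) → Set
AllNothing {A} = All (λ x → x ≡ nothing)

collapse′-nothings : {A : Set} (xs S : List (Maybe A)) → AllNothing xs → collapse′ (xs ++ S) ≡ collapse′ S
collapse′-nothings [] S _ = refl
collapse′-nothings (.nothing ∷ xs) S (refl ∷ n) = collapse′-nothings xs S n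

collapse-nothings : {A : Set} (xs S : List (Maybe A)) → xs ≢ [] → AllNothing xs → collapse (xs ++ S)
    ≡ nothing ∷ collapse′ S
collapse-nothings [] S ne _ = ⊥-elim (ne refl)
collapse-nothings (.nothing ∷ xs) S _ (refl ∷ n) = cong (nothing ∷_) (collapse′-nothings xs S n)

collapse-justs : {A : Set} (xs : List A) (S : List (Maybe A)) → collapse (map just xs ++ S)
    ≡ map just xs ++ collapse S
collapse-justs [] S = refl
collapse-justs (x ∷ xs) S = cong (just x ∷_) (collapse-justs xs S)

collapse′-justs : {A : Set} (xs : List A) (S : List (Maybe A)) → xs ≢ [] → collapse′ (map just xs ++ S)
    ≡ map just xs ++ collapse S
collapse′-justs [] S ne = ⊥-elim (ne refl)
collapse′-justs (x ∷ xs) S _ = cong (just x ∷_) (collapse-justs xs S)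

StartsJust : {A : Set} → List (Maybe A) → Set
StartsJust (just _ ∷ _) = ⊤
StartsJust _ = ⊥

collapse′-startsJust : {A : Set} (S : List (Maybe A)) → StartsJust S → collapse′ S ≡ collapse S
collapse′-startsJust (just x ∷ S) _ = refl

-- Letters on the far side of the threshold are sent to nothing; a predicate that ignores windows
-- centred at nothing cannot tell how long the resulting runs of nothing are.
countᵇ-windows-transfer : {A B C : Set} (F1 : Triple A → Bool) (F2 : Triple B → Bool) (G : Triple (Maybe C) → Bool)
  (f1 : A → Maybe C) (f2 : B → Maybe C) →
  (∀ x z → G (x , nothing , z) ≡ false) →
  (∀ T → F1 T ≡ G (mapTriple f1 T)) → (∀ T → F2 T ≡ G (mapTriple f2 T)) →
  (W1 : List A) (W2 : List B) → collapse (map f1 W1) ≡ collapse (map f2 W2) →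
  countᵇ F1 (windows W1) ≡ countᵇ F2 (windows W2)
countᵇ-windows-transfer F1 F2 G f1 f2 Gn e1 e2 W1 W2 eq = begin
  countᵇ F1 (windows W1) ≡⟨ countᵇ-cong F1 _ (windows W1) e1 ⟩
  countᵇ (λ T → G (mapTriple f1 T)) (windows W1) ≡⟨ sym (countᵇ-windows-map G f1 W1) ⟩
  countᵇ G (windows (map f1 W1)) ≡⟨ sym (Collapse.countᵇ-windows-collapse G Gn (map f1 W1)) ⟩
  countᵇ G (windows (collapse (map f1 W1))) ≡⟨ cong (λ z → countᵇ G (windows z)) eq ⟩
  countᵇ G (windows (collapse (map f2 W2))) ≡⟨ Collapse.countᵇ-windows-collapse G Gn (map f2 W2) ⟩
  countᵇ G (windows (map f2 W2)) ≡⟨ countᵇ-windows-map G f2 W2 ⟩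
  countᵇ (λ T → G (mapTriple f2 T)) (windows W2) ≡⟨ sym (countᵇ-cong F2 _ (windows W2) e2) ⟩
  countᵇ F2 (windows W2) ∎
  where open ≡-Reasoning

map-framed : {A : Set} (f : ℕ∞ → A) (w : List ℕ) → map f (framed w) ≡ f ∞ ∷ (map (λ y → f (fin y)) w ++ [ f ∞ ])
map-framed f w = cong (f ∞ ∷_) (trans (map-++ f (map fin w) [ ∞ ]) (cong (_++ [ f ∞ ]) (sym (map-∘ w))))

joinWith : ℕ → List (List ℕ) → List ℕ
joinWith c [] = []
joinWith c (x ∷ []) = x
joinWith c (x ∷ y ∷ r) = x ++ (c ∷ joinWith c (y ∷ r))

joinWith-∷ : (c x : ℕ) (p : List ℕ) (ps : List (List ℕ)) → joinWith c ((x ∷ p) ∷ ps) ≡ x ∷ joinWith c (p ∷ ps)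
joinWith-∷ c x p [] = refl
joinWith-∷ c x p (q ∷ ps) = refl

breakOn : ℕ → List ℕ → List ℕ × List (List ℕ)
breakOn c [] = ([] , [])
breakOn c (x ∷ w) = if x ≡ᵇ c then ([] , proj₁ (breakOn c w) ∷ proj₂ (breakOn c w)) else
    (x ∷ proj₁ (breakOn c w) , proj₂ (breakOn c w))

splitOn : ℕ → List ℕ → List (List ℕ)
splitOn c w = proj₁ (breakOn c w) ∷ proj₂ (breakOn c w)

splitOn-sep : (c x : ℕ) (w : List ℕ) → x ≡ c → splitOn c (x ∷ w) ≡ [] ∷ splitOn c w
splitOn-sep c x w e rewrite ≡ᵇ-true e = refl

splitOn-other : (c x : ℕ) (w : List ℕ) → x ≢ c → splitOn c (x ∷ w) ≡ (x ∷ proj₁ (breakOn c w)) ∷ proj₂ (breakOn c w)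
splitOn-other c x w e rewrite ≡ᵇ-false e = refl

joinWith-splitOn : (c : ℕ) (w : List ℕ) → joinWith c (splitOn c w) ≡ w
joinWith-splitOn c [] = refl
joinWith-splitOn c (x ∷ w) with x ≡ᵇ c in eq
... | true = cong₂ _∷_ (sym (≡ᵇ-true⁻ eq)) (joinWith-splitOn c w)
... | false = trans (joinWith-∷ c x (proj₁ (breakOn c w)) (proj₂ (breakOn c w))) (cong (x ∷_) (joinWith-splitOn c w))

Avoids : ℕ → List ℕ → Set
Avoids c = All (λ y → y ≢ c)

map-proj₁-zip : {A B : Set} (xs : List A) (ys : List B) → length xs ≡ length ys → map proj₁ (zip xs ys) ≡ xs
map-proj₁-zip [] [] _ = refl
map-proj₁-zip (x ∷ xs) (y ∷ ys) e = cong (x ∷_) (map-proj₁-zip xs ys (suc-injective e))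

length-zip : {A C : Set} (xs : List A) (ys : List C) → length xs ≡ length ys → length (zip xs ys) ≡ length xs
length-zip [] [] _ = refl
length-zip (x ∷ xs) (y ∷ ys) e = cong suc (length-zip xs ys (suc-injective e))

All-zip : {P : ℕ → Set} (xs ys : List (List ℕ)) → All (All P) xs → All (All P) ys →
  All (λ q → All P (proj₁ q) × All P (proj₂ q)) (zip xs ys)
All-zip [] _ _ _ = []
All-zip (x ∷ xs) [] _ _ = []
All-zip (x ∷ xs) (y ∷ ys) (a ∷ as) (b ∷ bs) = (a , b) ∷ All-zip xs ys as bs

occ-out-of-range : (K y : ℕ) (v : List ℕ) → All (_< K) v → K ≤ y → occ y v ≡ 0
occ-out-of-range K y [] _ _ = refl
occ-out-of-range K y (x ∷ v) (xk ∷ a) le = trans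
    (cong (_+ occ y v) (cong toℕ (≡ᵇ-false {x} {y} (λ e → <⇒≱ xk (subst (K ≤_) (sym e) le)))))
    (occ-out-of-range K y v a le)

uncons : List (List ℕ) → List ℕ × List (List ℕ)
uncons [] = ([] , [])
uncons (a ∷ b) = (a , b)

splitOn-joinWith : (c : ℕ) (p : List ℕ) (ps : List (List ℕ)) → Avoids c p → All (Avoids c) ps
    → splitOn c (joinWith c (p ∷ ps)) ≡ p ∷ ps
splitOn-joinWith c [] [] _ _ = refl
splitOn-joinWith c [] (q ∷ ps) _ (nq ∷ nps) = trans (splitOn-sep c c (joinWith c (q ∷ ps)) refl)
    (cong ([] ∷_) (splitOn-joinWith c q ps nq nps))
splitOn-joinWith c (x ∷ p) ps (nx ∷ np) nps =
  trans (cong (splitOn c) (joinWith-∷ c x p ps))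
  (trans (splitOn-other c x (joinWith c (p ∷ ps)) nx)
  (cong (λ z → (x ∷ proj₁ z) ∷ proj₂ z) (cong uncons (splitOn-joinWith c p ps np nps))))

splitOn-avoids : (c : ℕ) (w : List ℕ) → All (Avoids c) (splitOn c w)
splitOn-avoids c [] = [] ∷ []
splitOn-avoids c (x ∷ w) with x ≡ᵇ c in eq
... | true = [] ∷ splitOn-avoids c w
... | false with splitOn-avoids c w
...   | a ∷ as = (≡ᵇ-false⁻ eq ∷ a) ∷ as

length-breakOn : (c : ℕ) (w : List ℕ) → length (proj₂ (breakOn c w)) ≡ countᵇ (λ x → x ≡ᵇ c) w
length-breakOn c [] = refl
length-breakOn c (x ∷ w) with x ≡ᵇ c
... | true = cong suc (length-breakOn c w)
... | false = length-breakOn c w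

splitOn-All : {P : ℕ → Set} (c : ℕ) (w : List ℕ) → All P w → All (All P) (splitOn c w)
splitOn-All c [] _ = [] ∷ []
splitOn-All c (x ∷ w) (px ∷ a) with x ≡ᵇ c | splitOn-All c w a
... | true | r = [] ∷ r
... | false | (r ∷ rs) = (px ∷ r) ∷ rs

joinWith-All : {P : ℕ → Set} (c : ℕ) (xs : List (List ℕ)) → P c → All (All P) xs → All P (joinWith c xs)
joinWith-All c [] pc _ = []
joinWith-All c (x ∷ []) pc (a ∷ _) = a
joinWith-All c (x ∷ y ∷ r) pc (a ∷ as) = AllP.++⁺ a (pc ∷ joinWith-All c (y ∷ r) pc as)

occ-avoids : (c : ℕ) (p : List ℕ) → Avoids c p → occ c p ≡ 0
occ-avoids c [] _ = refl
occ-avoids c (x ∷ p) (n ∷ ns) rewrite ≡ᵇ-false n = occ-avoids c p ns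

occ-joinWith : (c : ℕ) (p : List ℕ) (ps : List (List ℕ)) → All (Avoids c) (p ∷ ps)
    → occ c (joinWith c (p ∷ ps)) ≡ length ps
occ-joinWith c p [] (n ∷ _) = occ-avoids c p n
occ-joinWith c p (q ∷ ps) (n ∷ ns) rewrite countᵇ-++ (λ x → x ≡ᵇ c) p (c ∷ joinWith c (q ∷ ps)) | occ-avoids c p n |
    ≡ᵇ-true {c} {c} refl =
  cong suc (occ-joinWith c q ps ns)

-- Separators that are pinnacles, zeros that are vales

isNonPinnacle : ℕ → Triple ℕ∞ → Bool
isNonPinnacle c (x , y , z) = isFin c y ∧ not ((x <ᵇ∞ y) ∧ (z <ᵇ∞ y))

countᵇ-windows-framedFrom : (F : Triple ℕ∞ → Bool) (e : ℕ∞) (x : ℕ) (u : List ℕ) →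
  countᵇ F (windows (framedFrom e (x ∷ u)))
      ≡ toℕ (F (e , fin x , nextOr∞ u)) + countᵇ F (windows (framedFrom (fin x) u))
countᵇ-windows-framedFrom F e x [] = refl
countᵇ-windows-framedFrom F e x (y ∷ u) = refl

NonEmpty : List ℕ → Set
NonEmpty l = l ≢ []

noWindow-∷⁻ : (F : Triple ℕ∞ → Bool) (e : ℕ∞) (x : ℕ) (u : List ℕ) →
  countᵇ F (windows (framedFrom e (x ∷ u))) ≡ 0 → countᵇ F (windows (framedFrom (fin x) u)) ≡ 0
noWindow-∷⁻ F e x u z = m+n≡0⇒n≡0 (toℕ (F (e , fin x , nextOr∞ u)))
    (trans (sym (countᵇ-windows-framedFrom F e x u)) z)

window-∷≢0 : (F : Triple ℕ∞ → Bool) (e : ℕ∞) (x : ℕ) (u : List ℕ) → F (e , fin x , nextOr∞ u) ≡ true →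
  countᵇ F (windows (framedFrom e (x ∷ u))) ≢ 0
window-∷≢0 F e x u t z =
  1+n≢0 (trans (cong (λ b → toℕ b + countᵇ F (windows (framedFrom (fin x) u))) (sym t))
      (trans (sym (countᵇ-windows-framedFrom F e x u)) z))

breakOn-sep-rest : (c : ℕ) (u : List ℕ) → proj₂ (breakOn c (c ∷ u)) ≡ splitOn c u
breakOn-sep-rest c u = ∷-injectiveʳ (splitOn-sep c c u refl)

breakOn-other-rest : (c x : ℕ) (u : List ℕ) → x ≢ c → proj₂ (breakOn c (x ∷ u)) ≡ proj₂ (breakOn c u)
breakOn-other-rest c x u ne = ∷-injectiveʳ (splitOn-other c x u ne)

breakOn-sep-first : (c : ℕ) (u : List ℕ) → proj₁ (breakOn c (c ∷ u)) ≡ []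
breakOn-sep-first c u = proj₁ (∷-injective (splitOn-sep c c u refl))

nonPinnacle-blocked : (c : ℕ) (e z : ℕ∞) → (e <ᵇ∞ fin c) ≡ false → isNonPinnacle c (e , fin c , z) ≡ true
nonPinnacle-blocked c e z h rewrite h | ≡ᵇ-true {c} {c} refl = refl

nonPinnacle-last : (c : ℕ) (e : ℕ∞) → isNonPinnacle c (e , fin c , ∞) ≡ true
nonPinnacle-last c e rewrite ≡ᵇ-true {c} {c} refl | ∧-zeroʳ (e <ᵇ∞ fin c) = refl

nonPinnacle-other : (c x : ℕ) (e z : ℕ∞) → x ≢ c → isNonPinnacle c (e , fin x , z) ≡ false
nonPinnacle-other c x e z ne rewrite ≡ᵇ-false ne = refl

nonPinnacle-peak : (c y x' : ℕ) → y < c → x' < c → isNonPinnacle c (fin y , fin c , fin x') ≡ false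
nonPinnacle-peak c y x' h1 h2 rewrite ≡ᵇ-true {c} {c} refl | <ᵇ-true h1 | <ᵇ-true h2 = refl

mutual
  noNonPinnacle⇒pieces-nonEmpty : (c : ℕ) (e : ℕ∞) (u : List ℕ) → (e <ᵇ∞ fin c) ≡ false → All (_≤ c) u → NonEmpty u →
    countᵇ (isNonPinnacle c) (windows (framedFrom e u)) ≡ 0 → All NonEmpty (splitOn c u)
  noNonPinnacle⇒pieces-nonEmpty c e [] h _ ne _ = ⊥-elim (ne refl)
  noNonPinnacle⇒pieces-nonEmpty c e (x ∷ u) h (xc ∷ al) _ z with x ≟ c
  ... | yes refl = ⊥-elim (window-∷≢0 (isNonPinnacle c) e c u (nonPinnacle-blocked c e (nextOr∞ u) h) z)
  ... | no x≢c = subst (All NonEmpty) (sym (splitOn-other c x u x≢c))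
         ((λ ()) ∷ noNonPinnacle⇒rest-nonEmpty c x u (≤∧≢⇒< xc x≢c) al (noWindow-∷⁻ (isNonPinnacle c) e x u z))

  noNonPinnacle⇒rest-nonEmpty : (c y : ℕ) (u : List ℕ) → y < c → All (_≤ c) u
      → countᵇ (isNonPinnacle c) (windows (framedFrom (fin y) u)) ≡ 0 → All NonEmpty (proj₂ (breakOn c u))
  noNonPinnacle⇒rest-nonEmpty c y [] _ _ _ = []
  noNonPinnacle⇒rest-nonEmpty c y (x ∷ u) yc (xc ∷ al) z with x ≟ c
  noNonPinnacle⇒rest-nonEmpty c y (x ∷ []) yc (xc ∷ al) z | yes refl = ⊥-elim
      (window-∷≢0 (isNonPinnacle c) (fin y) c [] (nonPinnacle-last c (fin y)) z)
  noNonPinnacle⇒rest-nonEmpty c y (x ∷ (x' ∷ u)) yc (xc ∷ al) z | yes refl = subst (All NonEmpty)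
      (sym (breakOn-sep-rest c (x' ∷ u)))
         (noNonPinnacle⇒pieces-nonEmpty c (fin c) (x' ∷ u) (<ᵇ-false {c} {c} ≤-refl) al (λ ())
             (noWindow-∷⁻ (isNonPinnacle c) (fin y) c (x' ∷ u) z))
  ... | no x≢c = subst (All NonEmpty) (sym (breakOn-other-rest c x u x≢c))
         (noNonPinnacle⇒rest-nonEmpty c x u (≤∧≢⇒< xc x≢c) al (noWindow-∷⁻ (isNonPinnacle c) (fin y) x u z))

nonPinnacle-peak′ : (c x y x' : ℕ) → x ≡ c → y < c → x' < c → isNonPinnacle c (fin y , fin x , fin x') ≡ false
nonPinnacle-peak′ c .c y x' refl h1 h2 = nonPinnacle-peak c y x' h1 h2

mutual
  pieces-nonEmpty⇒noNonPinnacle : (c : ℕ) (e : ℕ∞) (u : List ℕ) → (e <ᵇ∞ fin c) ≡ false → All (_≤ c) u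
      → All NonEmpty (splitOn c u) →
    countᵇ (isNonPinnacle c) (windows (framedFrom e u)) ≡ 0
  pieces-nonEmpty⇒noNonPinnacle c e [] h _ (ne ∷ _) = ⊥-elim (ne refl)
  pieces-nonEmpty⇒noNonPinnacle c e (x ∷ u) h al nes = pieces-nonEmpty⇒noNonPinnacle-∷ c e x u h al nes (x ≟ c)

  pieces-nonEmpty⇒noNonPinnacle-∷ : (c : ℕ) (e : ℕ∞) (x : ℕ) (u : List ℕ) → (e <ᵇ∞ fin c) ≡ false → All (_≤ c) (x ∷ u)
      → All NonEmpty (splitOn c (x ∷ u)) →
    Dec (x ≡ c) → countᵇ (isNonPinnacle c) (windows (framedFrom e (x ∷ u))) ≡ 0
  pieces-nonEmpty⇒noNonPinnacle-∷ c e x u h al nes (yes x≡c) = ⊥-elim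
      (All.head nes (subst (λ q → proj₁ (breakOn c (q ∷ u)) ≡ []) (sym x≡c) (breakOn-sep-first c u)))
  pieces-nonEmpty⇒noNonPinnacle-∷ c e x u h (xc ∷ al) nes (no x≢c) = trans
      (countᵇ-windows-framedFrom (isNonPinnacle c) e x u)
          (cong₂ _+_ (cong toℕ (nonPinnacle-other c x e (nextOr∞ u) x≢c))
            (rest-nonEmpty⇒noNonPinnacle c x u (≤∧≢⇒< xc x≢c) al
                (subst (All NonEmpty) (breakOn-other-rest c x u x≢c) (All.tail nes))))

  rest-nonEmpty⇒noNonPinnacle : (c y : ℕ) (u : List ℕ) → y < c → All (_≤ c) u → All NonEmpty (proj₂ (breakOn c u))
      → countᵇ (isNonPinnacle c) (windows (framedFrom (fin y) u)) ≡ 0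
  rest-nonEmpty⇒noNonPinnacle c y [] _ _ _ = refl
  rest-nonEmpty⇒noNonPinnacle c y (x ∷ []) yc al nes = rest-nonEmpty⇒noNonPinnacle-[x] c y x yc al nes (x ≟ c)
  rest-nonEmpty⇒noNonPinnacle c y (x ∷ (x' ∷ u)) yc al nes = rest-nonEmpty⇒noNonPinnacle-x∷y∷ c y x x' u yc al
      nes (x ≟ c) (x' ≟ c)

  rest-nonEmpty⇒noNonPinnacle-[x] : (c y x : ℕ) → y < c → All (_≤ c) (x ∷ [])
      → All NonEmpty (proj₂ (breakOn c (x ∷ []))) → Dec (x ≡ c) →
    countᵇ (isNonPinnacle c) (windows (framedFrom (fin y) (x ∷ []))) ≡ 0
  rest-nonEmpty⇒noNonPinnacle-[x] c y x yc al nes (yes x≡c) = ⊥-elim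
      (All.head (subst (All NonEmpty)
      (subst (λ q → proj₂ (breakOn c (q ∷ [])) ≡ splitOn c []) (sym x≡c) (breakOn-sep-rest c [])) nes) refl)
  rest-nonEmpty⇒noNonPinnacle-[x] c y x yc al nes (no x≢c) = cong₂ _+_
      (cong toℕ (nonPinnacle-other c x (fin y) ∞ x≢c)) refl

  rest-nonEmpty⇒noNonPinnacle-x∷y∷ : (c y x x' : ℕ) (u : List ℕ) → y < c → All (_≤ c) (x ∷ x' ∷ u)
      → All NonEmpty (proj₂ (breakOn c (x ∷ x' ∷ u))) →
    Dec (x ≡ c) → Dec (x' ≡ c) → countᵇ (isNonPinnacle c) (windows (framedFrom (fin y) (x ∷ x' ∷ u))) ≡ 0
  rest-nonEmpty⇒noNonPinnacle-x∷y∷ c y x x' u yc al nes (yes x≡c) (yes x'≡c) = ⊥-elim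
      (All.head (subst (All NonEmpty)
      (subst (λ q → proj₂ (breakOn c (q ∷ x' ∷ u)) ≡ splitOn c (x' ∷ u)) (sym x≡c) (breakOn-sep-rest c (x' ∷ u))) nes)
                                     (subst (λ q → proj₁ (breakOn c (q ∷ u)) ≡ []) (sym x'≡c)
                                         (breakOn-sep-first c u)))
  rest-nonEmpty⇒noNonPinnacle-x∷y∷ c y x x' u yc (xc ∷ (x'c ∷ al)) nes (yes x≡c) (no x'≢c) = cong₂ _+_
      (cong toℕ (nonPinnacle-peak′ c x y x' x≡c yc (≤∧≢⇒< x'c x'≢c)))
           (subst (λ q → countᵇ (isNonPinnacle c) (windows (framedFrom (fin q) (x' ∷ u))) ≡ 0) (sym x≡c)
             (pieces-nonEmpty⇒noNonPinnacle c (fin c) (x' ∷ u) (<ᵇ-false {c} {c} ≤-refl) (x'c ∷ al)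
               (subst (All NonEmpty) (subst (λ q → proj₂ (breakOn c (q ∷ x' ∷ u)) ≡ splitOn c (x' ∷ u)) (sym x≡c)
                   (breakOn-sep-rest c (x' ∷ u))) nes)))
  rest-nonEmpty⇒noNonPinnacle-x∷y∷ c y x x' u yc (xc ∷ al) nes (no x≢c) _ = trans
      (countᵇ-windows-framedFrom (isNonPinnacle c) (fin y) x (x' ∷ u))
          (cong₂ _+_ (cong toℕ (nonPinnacle-other c x (fin y) (nextOr∞ (x' ∷ u)) x≢c))
            (rest-nonEmpty⇒noNonPinnacle c x (x' ∷ u) (≤∧≢⇒< xc x≢c) al
                (subst (All NonEmpty) (breakOn-other-rest c x (x' ∷ u) x≢c) nes)))

InitNonEmpty : List (List ℕ) → Set
InitNonEmpty [] = ⊤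
InitNonEmpty (_ ∷ []) = ⊤
InitNonEmpty (h ∷ h' ∷ r) = (h ≢ []) × InitNonEmpty (h' ∷ r)

InitNonEmpty-∷ : (x : ℕ) (p : List ℕ) (ps : List (List ℕ)) → InitNonEmpty ps → InitNonEmpty ((x ∷ p) ∷ ps)
InitNonEmpty-∷ x p [] _ = tt
InitNonEmpty-∷ x p (q ∷ ps) n = (λ ()) , n

InitNonEmpty-tail : (x : ℕ) (p : List ℕ) (ps : List (List ℕ)) → InitNonEmpty ((x ∷ p) ∷ ps) → InitNonEmpty ps
InitNonEmpty-tail x p [] _ = tt
InitNonEmpty-tail x p (q ∷ ps) (_ , n) = n

mutual
  noBadZero⇒rest-initNonEmpty : (e : ℕ∞) (v : List ℕ) → (fin 0 <ᵇ∞ e) ≡ true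
      → countᵇ isBadZero (windows (framedFrom e v)) ≡ 0 → InitNonEmpty (proj₂ (breakOn 0 v))
  noBadZero⇒rest-initNonEmpty e [] _ _ = tt
  noBadZero⇒rest-initNonEmpty e (zero ∷ v) h z = noBadZero⇒initNonEmpty-after-0 v (noWindow-∷⁻ isBadZero e 0 v z)
  noBadZero⇒rest-initNonEmpty e (suc x ∷ v) h z = noBadZero⇒rest-initNonEmpty (fin (suc x)) v refl
      (noWindow-∷⁻ isBadZero e (suc x) v z)

  noBadZero⇒initNonEmpty-after-0 : (v : List ℕ) → countᵇ isBadZero (windows (framedFrom (fin 0) v)) ≡ 0
      → InitNonEmpty (splitOn 0 v)
  noBadZero⇒initNonEmpty-after-0 [] _ = tt
  noBadZero⇒initNonEmpty-after-0 (zero ∷ v) z = ⊥-elim (window-∷≢0 isBadZero (fin 0) 0 v refl z)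
  noBadZero⇒initNonEmpty-after-0 (suc x ∷ v) z = InitNonEmpty-∷ (suc x) (proj₁ (breakOn 0 v)) (proj₂ (breakOn 0 v))
      (noBadZero⇒rest-initNonEmpty (fin (suc x)) v refl (noWindow-∷⁻ isBadZero (fin 0) (suc x) v z))

isBadZero-before-suc : (e : ℕ∞) (x : ℕ) → (fin 0 <ᵇ∞ e) ≡ true → isBadZero (e , fin 0 , fin (suc x)) ≡ false
isBadZero-before-suc e x h rewrite h = refl

isBadZero-before-∞ : (e : ℕ∞) → (fin 0 <ᵇ∞ e) ≡ true → isBadZero (e , fin 0 , ∞) ≡ false
isBadZero-before-∞ e h rewrite h = refl

mutual
  rest-initNonEmpty⇒noBadZero : (e : ℕ∞) (v : List ℕ) → (fin 0 <ᵇ∞ e) ≡ true → InitNonEmpty (proj₂ (breakOn 0 v))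
      → countᵇ isBadZero (windows (framedFrom e v)) ≡ 0
  rest-initNonEmpty⇒noBadZero e [] _ _ = refl
  rest-initNonEmpty⇒noBadZero e (zero ∷ []) h n = cong₂ _+_ (cong toℕ (isBadZero-before-∞ e h)) refl
  rest-initNonEmpty⇒noBadZero e (zero ∷ (zero ∷ v)) h (ne , _) = ⊥-elim (ne refl)
  rest-initNonEmpty⇒noBadZero e (zero ∷ (suc x ∷ v)) h n = cong₂ _+_ (cong toℕ (isBadZero-before-suc e (suc x) h))
      (initNonEmpty⇒noBadZero-after-0 (suc x ∷ v) n)
  rest-initNonEmpty⇒noBadZero e (suc x ∷ v) h n = trans (countᵇ-windows-framedFrom isBadZero e (suc x) v)
      (rest-initNonEmpty⇒noBadZero (fin (suc x)) v refl n)

  initNonEmpty⇒noBadZero-after-0 : (v : List ℕ) → InitNonEmpty (splitOn 0 v)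
      → countᵇ isBadZero (windows (framedFrom (fin 0) v)) ≡ 0
  initNonEmpty⇒noBadZero-after-0 [] _ = refl
  initNonEmpty⇒noBadZero-after-0 (zero ∷ v) (ne , _) = ⊥-elim (ne refl)
  initNonEmpty⇒noBadZero-after-0 (suc x ∷ v) n = trans (countᵇ-windows-framedFrom isBadZero (fin 0) (suc x) v)
      (rest-initNonEmpty⇒noBadZero (fin (suc x)) v refl
          (InitNonEmpty-tail (suc x) (proj₁ (breakOn 0 v)) (proj₂ (breakOn 0 v)) n))

countᵇ-middle≡pinnacles+nonPinnacles : (c : ℕ) (S : List (Triple ℕ∞)) → countᵇ (λ T → isFin c (middle T)) S
    ≡ countᵇ (isPinnacle c) S + countᵇ (isNonPinnacle c) S
countᵇ-middle≡pinnacles+nonPinnacles c [] = refl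
countᵇ-middle≡pinnacles+nonPinnacles c ((x , y , z) ∷ S) = trans
    (cong₂ _+_ (one (isFin c y) ((x <ᵇ∞ y) ∧ (z <ᵇ∞ y))) (countᵇ-middle≡pinnacles+nonPinnacles c S))
    (interchange (toℕ (isFin c y ∧ ((x <ᵇ∞ y) ∧ (z <ᵇ∞ y)))) (toℕ (isFin c y ∧ not ((x <ᵇ∞ y) ∧ (z <ᵇ∞ y)))) _ _)
  where
  one : (a q : Bool) → toℕ a ≡ toℕ (a ∧ q) + toℕ (a ∧ not q)
  one false q = refl
  one true true = refl
  one true false = refl

no-pinnacle-0 : (S : List (Triple ℕ∞)) → countᵇ (isPinnacle 0) S ≡ 0
no-pinnacle-0 S = trans (countᵇ-cong (isPinnacle 0) (λ _ → false) S f) (cz S)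
  where
  f : (T : Triple ℕ∞) → isPinnacle 0 T ≡ false
  f (x , ∞ , z) = refl
  f (∞ , fin zero , z) = refl
  f (fin a , fin zero , z) = refl
  f (x , fin (suc y) , z) = refl
  cz : (S : List (Triple ℕ∞)) → countᵇ (λ _ → false) S ≡ 0
  cz [] = refl
  cz (_ ∷ S) = cz S

pinnacles≡occ⇒noNonPinnacle : (c : ℕ) (w : List ℕ) → pinnacleCount c w ≡ occ c w
    → countᵇ (isNonPinnacle c) (windows (framed w)) ≡ 0
pinnacles≡occ⇒noNonPinnacle c w e = +-cancelˡ-≡ (pinnacleCount c w) _ 0
    (trans (sym (countᵇ-middle≡pinnacles+nonPinnacles c (windows (framed w))))
    (trans (sym (occ≡countᵇ-middle c w)) (trans (sym e) (sym (+-identityʳ _)))))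

noNonPinnacle⇒pinnacles≡occ : (c : ℕ) (w : List ℕ) → countᵇ (isNonPinnacle c) (windows (framed w)) ≡ 0
    → pinnacleCount c w ≡ occ c w
noNonPinnacle⇒pinnacles≡occ c w e = trans (sym (+-identityʳ _))
    (trans (cong (pinnacleCount c w +_) (sym e))
    (sym (trans (occ≡countᵇ-middle c w) (countᵇ-middle≡pinnacles+nonPinnacles c (windows (framed w))))))

-- Zeros and peaks

isPeak : Triple ℕ∞ → Bool
isPeak (x , y , z) = (x <ᵇ∞ y) ∧ (z <ᵇ∞ y)

peaksFrom : ℕ∞ → ℕ → List ℕ → ℕ
peaksFrom p q v = countᵇ isPeak (windows (framedFrom p (q ∷ v)))

NoAdjacentRepeat : List ℕ → Set
NoAdjacentRepeat (x ∷ y ∷ r) = (x ≢ y) × NoAdjacentRepeat (y ∷ r)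
NoAdjacentRepeat _ = ⊤

<ᵇ∞-asym : (q : ℕ) (p : ℕ∞) → (fin q <ᵇ∞ p) ≡ true → (p <ᵇ∞ fin q) ≡ false
<ᵇ∞-asym q ∞ _ = refl
<ᵇ∞-asym q (fin p) h = <ᵇ-false {p} {q} (<⇒≤ (<ᵇ-true⁻ {q} {p} h))

mutual
  zeros≤peaks-rising : (p : ℕ∞) (q : ℕ) (v : List ℕ) → (p <ᵇ∞ fin q) ≡ true → NoAdjacentRepeat (q ∷ v)
      → occ 0 v ≤ peaksFrom p q v
  zeros≤peaks-rising p q [] h nad = z≤n
  zeros≤peaks-rising p q (x ∷ v) h (q≢x , nad) = zeros≤peaks-rising-cmp p q x v h q≢x nad (<-cmp x q)

  zeros≤peaks-rising-cmp : (p : ℕ∞) (q x : ℕ) (v : List ℕ) → (p <ᵇ∞ fin q) ≡ true → q ≢ x → NoAdjacentRepeat (x ∷ v) →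
    Tri (x < q) (x ≡ q) (q < x) → occ 0 (x ∷ v) ≤ peaksFrom p q (x ∷ v)
  zeros≤peaks-rising-cmp p q zero v h q≢x nad (tri< x<q _ _) rewrite h | <ᵇ-true {0} {q} x<q = s≤s
      (zeros≤peaks-at-0 (fin q) v nad)
  zeros≤peaks-rising-cmp p q (suc x) v h q≢x nad (tri< x<q _ _) rewrite h | <ᵇ-true {suc x} {q} x<q =
    zeros≤peaks-falling (fin q) (suc x) v (<ᵇ-true {suc x} {q} x<q) (s≤s z≤n) nad
  zeros≤peaks-rising-cmp p q x v h q≢x nad (tri≈ _ x≡q _) = ⊥-elim (q≢x (sym x≡q))
  zeros≤peaks-rising-cmp p q zero v h q≢x nad (tri> _ _ ())
  zeros≤peaks-rising-cmp p q (suc x) v h q≢x nad (tri> _ _ q<x) rewrite h | <ᵇ-false {suc x} {q} (<⇒≤ q<x) =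
    zeros≤peaks-rising (fin q) (suc x) v (<ᵇ-true {q} {suc x} q<x) nad

  zeros≤peaks-falling : (p : ℕ∞) (q : ℕ) (v : List ℕ) → (fin q <ᵇ∞ p) ≡ true → 1 ≤ q → NoAdjacentRepeat (q ∷ v)
      → occ 0 v ≤ suc (peaksFrom p q v)
  zeros≤peaks-falling p q [] h _ nad = z≤n
  zeros≤peaks-falling p q (x ∷ v) h 1≤q (q≢x , nad) = zeros≤peaks-falling-cmp p q x v h q≢x nad (<-cmp x q)

  zeros≤peaks-falling-cmp : (p : ℕ∞) (q x : ℕ) (v : List ℕ) → (fin q <ᵇ∞ p) ≡ true → q ≢ x
      → NoAdjacentRepeat (x ∷ v) →
    Tri (x < q) (x ≡ q) (q < x) → occ 0 (x ∷ v) ≤ suc (peaksFrom p q (x ∷ v))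
  zeros≤peaks-falling-cmp p q zero v h q≢x nad (tri< x<q _ _) rewrite <ᵇ∞-asym q p h = s≤s
      (zeros≤peaks-at-0 (fin q) v nad)
  zeros≤peaks-falling-cmp p q (suc x) v h q≢x nad (tri< x<q _ _) rewrite <ᵇ∞-asym q p h =
    zeros≤peaks-falling (fin q) (suc x) v (<ᵇ-true {suc x} {q} x<q) (s≤s z≤n) nad
  zeros≤peaks-falling-cmp p q x v h q≢x nad (tri≈ _ x≡q _) = ⊥-elim (q≢x (sym x≡q))
  zeros≤peaks-falling-cmp p q zero v h q≢x nad (tri> _ _ ())
  zeros≤peaks-falling-cmp p q (suc x) v h q≢x nad (tri> _ _ q<x) rewrite <ᵇ∞-asym q p h =
    ≤-trans (zeros≤peaks-rising (fin q) (suc x) v (<ᵇ-true {q} {suc x} q<x) nad) (n≤1+n _)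

  zeros≤peaks-at-0 : (p : ℕ∞) (v : List ℕ) → NoAdjacentRepeat (0 ∷ v) → occ 0 v ≤ peaksFrom p 0 v
  zeros≤peaks-at-0 p [] _ = z≤n
  zeros≤peaks-at-0 p (zero ∷ v) (ne , _) = ⊥-elim (ne refl)
  zeros≤peaks-at-0 p (suc x ∷ v) (_ , nad) = subst (λ b → occ 0 v ≤ toℕ b + peaksFrom (fin 0) (suc x) v) (sym (lt0 p))
       (zeros≤peaks-rising (fin 0) (suc x) v refl nad)
    where
    lt0 : (p : ℕ∞) → ((p <ᵇ∞ fin 0) ∧ (fin (suc x) <ᵇ∞ fin 0)) ≡ false
    lt0 ∞ = refl
    lt0 (fin a) = refl

occ0≤1+peaks : (v : List ℕ) → NoAdjacentRepeat v → occ 0 v ≤ suc (countᵇ isPeak (windows (framed v)))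
occ0≤1+peaks [] _ = z≤n
occ0≤1+peaks (zero ∷ v) nad = s≤s (zeros≤peaks-at-0 ∞ v nad)
occ0≤1+peaks (suc x ∷ v) nad = zeros≤peaks-falling ∞ (suc x) v refl (s≤s z≤n) nad

isBadZero-0-0 : (e : ℕ∞) → isBadZero (e , fin 0 , fin 0) ≡ true
isBadZero-0-0 e rewrite ∧-zeroʳ (fin 0 <ᵇ∞ e) = refl

nonPinnacle-repeat : (M : ℕ) (e : ℕ∞) → isNonPinnacle M (e , fin M , fin M) ≡ true
nonPinnacle-repeat M e rewrite ≡ᵇ-true {M} {M} refl | <ᵇ-false {M} {M} ≤-refl | ∧-zeroʳ (e <ᵇ∞ fin M) = refl

windows-framedFrom-∷ : (e : ℕ∞) (x : ℕ) (u : List ℕ) → windows (framedFrom e (x ∷ u))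
    ≡ (e , fin x , nextOr∞ u) ∷ windows (framedFrom (fin x) u)
windows-framedFrom-∷ e x [] = refl
windows-framedFrom-∷ e x (y ∷ u) = refl

repeat-contradiction : (M : ℕ) (e : ℕ∞) (x : ℕ) (r : List ℕ)
    → countᵇ isBadZero (windows (framedFrom e (x ∷ x ∷ r))) ≡ 0 →
  countᵇ (isNonPinnacle M) (windows (framedFrom e (x ∷ x ∷ r))) ≡ 0
      → (∀ y → 1 ≤ y → y ≢ M → occ y (x ∷ x ∷ r) ≤ 1) → ⊥
repeat-contradiction M e zero r z b o = window-∷≢0 isBadZero e 0 (0 ∷ r) (isBadZero-0-0 e) z
repeat-contradiction M e (suc y) r z b o with M ≟ suc y
... | yes refl = window-∷≢0 (isNonPinnacle M) e M (M ∷ r) (nonPinnacle-repeat M e) b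
... | no ne = subst (λ q → toℕ q + (toℕ q + occ (suc y) r) ≤ 1 → ⊥) (sym (≡ᵇ-true {y} {y} refl)) (λ { (s≤s ()) })
    (o (suc y) (s≤s z≤n) (λ e → ne (sym e)))

noAdjacentRepeat : (M : ℕ) (e : ℕ∞) (v : List ℕ) → countᵇ isBadZero (windows (framedFrom e v)) ≡ 0
    → countᵇ (isNonPinnacle M) (windows (framedFrom e v)) ≡ 0 →
  (∀ y → 1 ≤ y → y ≢ M → occ y v ≤ 1) → NoAdjacentRepeat v
noAdjacentRepeat M e [] _ _ _ = tt
noAdjacentRepeat M e (x ∷ []) _ _ _ = tt
noAdjacentRepeat M e (x ∷ x' ∷ r) z b o = neq , noAdjacentRepeat M (fin x) (x' ∷ r) z' b' o'
  where
  z' : countᵇ isBadZero (windows (framedFrom (fin x) (x' ∷ r))) ≡ 0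
  z' = noWindow-∷⁻ isBadZero e x (x' ∷ r) z
  b' : countᵇ (isNonPinnacle M) (windows (framedFrom (fin x) (x' ∷ r))) ≡ 0
  b' = noWindow-∷⁻ (isNonPinnacle M) e x (x' ∷ r) b

  o' : ∀ y → 1 ≤ y → y ≢ M → occ y (x' ∷ r) ≤ 1
  o' y h1 h2 = ≤-trans (m≤n+m (occ y (x' ∷ r)) (toℕ (x ≡ᵇ y))) (o y h1 h2)
  neq : x ≢ x'
  neq refl = repeat-contradiction M e x r z b o

MiddleBelow : ℕ → Triple ℕ∞ → Set
MiddleBelow K T = Σ ℕ (λ y → (middle T ≡ fin y) × (y < K))

windows-middleBelow : (K : ℕ) (e : ℕ∞) (v : List ℕ) → All (_< K) v → All (MiddleBelow K) (windows (framedFrom e v))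
windows-middleBelow K e [] _ = []
windows-middleBelow K e (x ∷ v) (xk ∷ a) = subst (All (MiddleBelow K)) (sym (windows-framedFrom-∷ e x v))
    ((x , refl , xk) ∷ windows-middleBelow K (fin x) v a)

sumBelow-≡ᵇ-∧ : (K y : ℕ) (q : Bool) → y < K → sumBelow K (λ c → toℕ ((y ≡ᵇ c) ∧ q)) ≡ toℕ q
sumBelow-≡ᵇ-∧ K y true yK = trans (sumBelow-cong K _ _ (λ c _ → cong toℕ (∧-identityʳ (y ≡ᵇ c)))) (sumBelow-≡ᵇ K y yK)
sumBelow-≡ᵇ-∧ K y false yK = trans (sumBelow-cong K _ _ (λ c _ → cong toℕ (∧-zeroʳ (y ≡ᵇ c)))) (sumBelow-zero K)

peaks≡sumBelow-pinnacles : (K : ℕ) (S : List (Triple ℕ∞)) → All (MiddleBelow K) S → countᵇ isPeak S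
    ≡ sumBelow K (λ c → countᵇ (isPinnacle c) S)
peaks≡sumBelow-pinnacles K [] _ = sym (sumBelow-zero K)
peaks≡sumBelow-pinnacles K ((x , .(fin y) , z) ∷ S) ((y , refl , yK) ∷ a) =
  trans (cong₂ _+_ (sym (sumBelow-≡ᵇ-∧ K y ((x <ᵇ∞ fin y) ∧ (z <ᵇ∞ fin y)) yK)) (peaks≡sumBelow-pinnacles K S a))
      (sym (sumBelow-+ K _ _))

Valid : Block → ℕ → ℕ → List ℕ → Set
Valid B i j w = (∀ c → c < suc (suc (length B)) → occ c w ≡ multArr (length B) i j c) ×
                (∀ c → c < suc (suc (length B)) → pinnacleCount c w ≡ multPin B i c) × (badZeroCount w ≡ 0)

∧-split : (a b c : Bool) → a ∧ b ∧ c ≡ true → (a ≡ true) × (b ≡ true) × (c ≡ true)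
∧-split true true true _ = refl , refl , refl

inP⇒Valid : (B : Block) (i j : ℕ) (w : List ℕ) → inP B i j w ≡ true → Valid B i j w
inP⇒Valid B i j w e with ∧-split (isArrangement (length B) i j w) (pinnacleOK B i w) (allZerosCyclicVales w) e
... | e1 , e2 , e3 =
  (λ c c< → trans (sym (countOcc≡occ c w)) (≡ᵇ-true⁻ {countOcc c w} {multArr (length B) i j c}
     (all-applyUpTo⁻ (λ v → countOcc v w ≡ᵇ multArr (length B) i j v) (λ x → x) (suc (suc (length B))) e1 c c<))) ,
  (λ c c< → trans (sym (occ-pinnacles c w))
      (trans (sym (countOcc≡occ c (pinnacles w))) (≡ᵇ-true⁻ {countOcc c (pinnacles w)} {multPin B i c}
     (all-applyUpTo⁻ (λ v → countOcc v (pinnacles w) ≡ᵇ multPin B i v) (λ x → x) (suc (suc (length B))) e2 c c<)))) ,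
  ≡ᵇ-true⁻ (trans (sym (allZerosCyclicVales-windows w)) e3)

Valid⇒inP : (B : Block) (i j : ℕ) (w : List ℕ) → Valid B i j w → inP B i j w ≡ true
Valid⇒inP B i j w (v1 , v2 , v3) rewrite
    all-applyUpTo⁺ (λ v → countOcc v w ≡ᵇ multArr (length B) i j v) (λ x → x) (suc (suc (length B)))
      (λ c c< → ≡ᵇ-true (trans (countOcc≡occ c w) (v1 c c<)))
  | all-applyUpTo⁺ (λ v → countOcc v (pinnacles w) ≡ᵇ multPin B i v) (λ x → x) (suc (suc (length B)))
      (λ c c< → ≡ᵇ-true (trans (countOcc≡occ c (pinnacles w)) (trans (occ-pinnacles c w) (v2 c c<))))
  | allZerosCyclicVales-windows w | v3 = refl

sumBelow-last : (m i : ℕ) (g : ℕ → ℕ) → sumBelow (suc m) (λ c → if c ≡ᵇ m then i else g c) ≡ sumBelow m g + i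
sumBelow-last zero i g = +-identityʳ i
sumBelow-last (suc m) i g = trans (cong (g 0 +_) (sumBelow-last m i (λ c → g (suc c)))) (sym (+-assoc (g 0) _ i))

sumBelow-one : (m : ℕ) → sumBelow m (λ _ → 1) ≡ m
sumBelow-one zero = refl
sumBelow-one (suc m) = cong suc (sumBelow-one m)

sumBelow-multArr : (m i j : ℕ) → sumBelow (suc (suc m)) (multArr m i j) ≡ m + i + j
sumBelow-multArr m i j = trans
    (cong (j +_) (trans (sumBelow-last m i (λ _ → 1)) (cong (_+ i) (sumBelow-one m)))) (+-comm j (m + i))

inP? : (B : Block) (i j : ℕ) → Decidable (λ w → inP B i j w ≡ true)
inP? B i j w = inP B i j w Data.Bool.≟ true

Admissible : Block → ℕ → ℕ → List (List ℕ)
Admissible B i j = filter (inP? B i j) (words (suc (suc (length B))) (length B + i + j))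

Admissible-unique : (B : Block) (i j : ℕ) → Unique (Admissible B i j)
Admissible-unique B i j = UP.filter⁺ (inP? B i j) (words-unique (suc (suc (length B))) (length B + i + j))

∈-Admissible⁺ : (B : Block) (i j : ℕ) (w : List ℕ) → Valid B i j w → All (_< suc (suc (length B))) w
    → w ∈ Admissible B i j
∈-Admissible⁺ B i j w val bd = ∈-filter⁺ (inP? B i j)
  (∈-words⁺ _ _ w (trans (length≡sumBelow-occ _ w bd)
      (trans (sumBelow-cong _ _ _ (proj₁ val)) (sumBelow-multArr (length B) i j))) bd)
  (Valid⇒inP B i j w val)

∈-Admissible⁻ : (B : Block) (i j : ℕ) (w : List ℕ) → w ∈ Admissible B i j → Valid B i j w
    × All (_< suc (suc (length B))) w
∈-Admissible⁻ B i j w mem with ∈-filter⁻ (inP? B i j) {xs = words (suc (suc (length B))) (length B + i + j)} mem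
... | wW , e = inP⇒Valid B i j w e , proj₂ (∈-words⁻ (suc (suc (length B))) (length B + i + j) w wW)

bitAt-zero : (B : Block) → bitAt B 0 ≡ false
bitAt-zero [] = refl
bitAt-zero (x ∷ B) = refl

sumBelow-bitAt : (B : Block) → sumBelow (length B) (λ c → toℕ (bitAt B (suc c))) ≡ ones B
sumBelow-bitAt [] = refl
sumBelow-bitAt (true ∷ B) = cong suc (trans (sumBelow-cong (length B) _ _ (λ c _ → refl)) (sumBelow-bitAt B))
sumBelow-bitAt (false ∷ B) = trans (sumBelow-cong (length B) _ _ (λ c _ → refl)) (sumBelow-bitAt B)

sumBelow-multPin : (B : Block) (i : ℕ) → sumBelow (suc (suc (length B))) (multPin B i) ≡ ones B + i
sumBelow-multPin B i rewrite bitAt-zero B = trans (sumBelow-last (length B) i (λ c → toℕ (bitAt B (suc c))))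
    (cong (_+ i) (sumBelow-bitAt B))

bitAt-++ˡ : (B1 B2 : Block) (c : ℕ) → c ≤ length B1 → bitAt (B1 ++ B2) c ≡ bitAt B1 c
bitAt-++ˡ B1 B2 zero _ = trans (bitAt-zero (B1 ++ B2)) (sym (bitAt-zero B1))
bitAt-++ˡ [] B2 (suc c) ()
bitAt-++ˡ (x ∷ B1) B2 (suc zero) _ = refl
bitAt-++ˡ (x ∷ B1) B2 (suc (suc c)) (s≤s le) = bitAt-++ˡ B1 B2 (suc c) le

bitAt-++ʳ : (B1 B2 : Block) (c : ℕ) → 1 ≤ c → bitAt (B1 ++ B2) (c + length B1) ≡ bitAt B2 c
bitAt-++ʳ [] B2 c _ = cong (bitAt B2) (+-identityʳ c)
bitAt-++ʳ (x ∷ B1) B2 (suc c) _ rewrite +-suc c (length B1) = bitAt-++ʳ B1 B2 (suc c) (s≤s z≤n)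

+-≡ᵇ-suc : (c k m : ℕ) → (c + k ≡ᵇ suc (k + m)) ≡ (c ≡ᵇ suc m)
+-≡ᵇ-suc c k m = truth-ext (λ t
    → ≡ᵇ-true {c} {suc m} (+-cancelʳ-≡ k c (suc m)
    (trans (≡ᵇ-true⁻ {c + k} {suc (k + m)} t) (cong suc (+-comm k m)))))
                         (λ t → ≡ᵇ-true {c + k} {suc (k + m)}
                             (trans (cong (_+ k) (≡ᵇ-true⁻ {c} {suc m} t)) (cong suc (+-comm m k))))

module Concatenation (B1 B2 : Block) where
  k = length B1
  m = length B2

  length-B : length (B1 ++ B2) ≡ k + m
  length-B = length-++ B1

  ≢ᵇ-top : (c : ℕ) → c ≤ k → (c ≡ᵇ suc (length (B1 ++ B2))) ≡ false
  ≢ᵇ-top c c≤k = ≡ᵇ-false (λ e → <⇒≱ (s≤s (≤-trans c≤k (subst (k ≤_) (sym length-B) (m≤m+n k m))))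
      (≤-reflexive (sym e)))

  ≢ᵇ-suc-k : (c : ℕ) → c ≤ k → (c ≡ᵇ suc k) ≡ false
  ≢ᵇ-suc-k c c≤k = ≡ᵇ-false (λ e → <⇒≱ (s≤s c≤k) (≤-reflexive (sym e)))

  multArr-low : (i j a c : ℕ) → c ≤ k → multArr (length (B1 ++ B2)) i j c ≡ multArr k a j c
  multArr-low i j a zero _ = refl
  multArr-low i j a (suc c) c≤k rewrite ≢ᵇ-top (suc c) c≤k | ≢ᵇ-suc-k (suc c) c≤k = refl

  multArr-top : (a j : ℕ) → multArr k a j (suc k) ≡ a
  multArr-top a j rewrite ≡ᵇ-true {k} {k} refl = refl

  multArr-high : (i j a c : ℕ) → 1 ≤ c → multArr (length (B1 ++ B2)) i j (c + k) ≡ multArr m i a c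
  multArr-high i j a (suc c) _ rewrite length-B | +-≡ᵇ-suc (suc c) k m = refl

  multPin-low : (i a c : ℕ) → c ≤ k → multPin (B1 ++ B2) i c ≡ multPin B1 a c
  multPin-low i a c c≤k rewrite ≢ᵇ-top c c≤k | ≢ᵇ-suc-k c c≤k | bitAt-++ˡ B1 B2 c c≤k = refl

  multPin-top : (a : ℕ) → multPin B1 a (suc k) ≡ a
  multPin-top a rewrite ≡ᵇ-true {k} {k} refl = refl

  multPin-high : (i c : ℕ) → 1 ≤ c → multPin (B1 ++ B2) i (c + k) ≡ multPin B2 i c
  multPin-high i c 1≤c rewrite length-B | +-≡ᵇ-suc c k m | bitAt-++ʳ B1 B2 c 1≤c = refl

  multPin-zero : (i : ℕ) → multPin B2 i 0 ≡ 0
  multPin-zero i rewrite bitAt-zero B2 = refl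

-- Low and high runs

-- (h₀ , [(l₁ , h₁), …, (l_r , h_r)]) stands for the word h₀ l₁ h₁ ⋯ l_r h_r.
Runs : Set
Runs = List ℕ × List (List ℕ × List ℕ)

interleave : List ℕ → List (List ℕ × List ℕ) → List ℕ
interleave h0 [] = h0
interleave h0 ((l , h) ∷ ps) = h0 ++ (l ++ interleave h ps)

flatten : Runs → List ℕ
flatten (h0 , ps) = interleave h0 ps

map-interleave-∷ : {A : Set} (f : ℕ → A) (h0 : List ℕ) (l : List ℕ) (h : List ℕ)
    (ps : List (List ℕ × List ℕ)) (S : List A) →
  map f (interleave h0 ((l , h) ∷ ps)) ++ S ≡ map f h0 ++ (map f l ++ (map f (interleave h ps) ++ S))
map-interleave-∷ f h0 l h ps S = begin
  map f (h0 ++ (l ++ interleave h ps)) ++ S ≡⟨ cong (_++ S) (map-++ f h0 (l ++ interleave h ps)) ⟩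
  (map f h0 ++ map f (l ++ interleave h ps)) ++ S ≡⟨ ++-assoc (map f h0) _ S ⟩
  map f h0 ++ (map f (l ++ interleave h ps) ++ S)
      ≡⟨ cong (λ z → map f h0 ++ (z ++ S)) (map-++ f l (interleave h ps)) ⟩
  map f h0 ++ ((map f l ++ map f (interleave h ps)) ++ S) ≡⟨ cong (map f h0 ++_) (++-assoc (map f l) _ S) ⟩
  map f h0 ++ (map f l ++ (map f (interleave h ps) ++ S)) ∎
  where open ≡-Reasoning

All-interleave⁻ : {P : ℕ → Set} (h0 : List ℕ) (ps : List (List ℕ × List ℕ)) → All P (interleave h0 ps) →
  All P h0 × All (λ q → All P (proj₁ q) × All P (proj₂ q)) ps
All-interleave⁻ h0 [] a = a , []
All-interleave⁻ h0 ((l , h) ∷ ps) a with AllP.++⁻ h0 a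
... | a0 , a1 with AllP.++⁻ l a1
...   | al , a2 with All-interleave⁻ h ps a2
...     | ah , aps = a0 , ((al , ah) ∷ aps)

All-interleave⁺ : {P : ℕ → Set} (h0 : List ℕ) (ps : List (List ℕ × List ℕ)) →
  All P h0 → All (λ q → All P (proj₁ q) × All P (proj₂ q)) ps → All P (interleave h0 ps)
All-interleave⁺ h0 [] a0 _ = a0
All-interleave⁺ h0 ((l , h) ∷ ps) a0 ((al , ah) ∷ aps) = AllP.++⁺ a0 (AllP.++⁺ al (All-interleave⁺ h ps ah aps))

module Threshold (k : ℕ) where

  High : List ℕ → Set
  High = All (λ x → (k <ᵇ x) ≡ true)

  Low : List ℕ → Set
  Low = All (λ x → (k <ᵇ x) ≡ false)

  consLow : ℕ → List ℕ → List (List ℕ × List ℕ) → Runs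
  consLow x [] [] = ([] , ([ x ] , []) ∷ [])
  consLow x [] ((l , h) ∷ ps) = ([] , (x ∷ l , h) ∷ ps)
  consLow x (y ∷ h0) ps = ([] , ([ x ] , y ∷ h0) ∷ ps)

  consLetter : ℕ → Runs → Runs
  consLetter x (h0 , ps) = if k <ᵇ x then (x ∷ h0 , ps) else consLow x h0 ps

  toRuns : List ℕ → Runs
  toRuns [] = ([] , [])
  toRuns (x ∷ w) = consLetter x (toRuns w)

  flatten-consLetter : (x : ℕ) (s : Runs) → flatten (consLetter x s) ≡ x ∷ flatten s
  flatten-consLetter x (h0 , ps) with k <ᵇ x
  flatten-consLetter x (h0 , []) | true = refl
  flatten-consLetter x (h0 , _ ∷ _) | true = refl
  flatten-consLetter x ([] , []) | false = refl
  flatten-consLetter x ([] , _ ∷ _) | false = refl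
  flatten-consLetter x (_ ∷ _ , []) | false = refl
  flatten-consLetter x (_ ∷ _ , _ ∷ _) | false = refl

  flatten-toRuns : (w : List ℕ) → flatten (toRuns w) ≡ w
  flatten-toRuns [] = refl
  flatten-toRuns (x ∷ w) = trans (flatten-consLetter x (toRuns w)) (cong (x ∷_) (flatten-toRuns w))

  data Alternating : List (List ℕ × List ℕ) → Set where
    last : ∀ {l h} → l ≢ [] → Low l → High h → Alternating ((l , h) ∷ [])
    cons : ∀ {l h ps} → l ≢ [] → Low l → High h → h ≢ [] → Alternating ps → Alternating ((l , h) ∷ ps)

  Canonical : Runs → Set
  Canonical s = High (proj₁ s) × Alternating (proj₂ s)

  Canonical′ : Runs → Set
  Canonical′ s = High (proj₁ s) × (proj₂ s ≡ [] ⊎ Alternating (proj₂ s))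

  consLow-canonical : (x : ℕ) (h0 : List ℕ) (ps : List (List ℕ × List ℕ)) → (k <ᵇ x) ≡ false → Canonical′ (h0 , ps)
      → Canonical′ (consLow x h0 ps)
  consLow-canonical x [] [] lx _ = [] , inj₂ (last (λ ()) (lx ∷ []) [])
  consLow-canonical x [] (_ ∷ _) lx (_ , inj₁ ())
  consLow-canonical x [] (_ ∷ []) lx (_ , inj₂ (last _ lo hi)) = [] , inj₂ (last (λ ()) (lx ∷ lo) hi)
  consLow-canonical x [] (_ ∷ _) lx (_ , inj₂ (cons _ lo hi hne c)) = [] , inj₂ (cons (λ ()) (lx ∷ lo) hi hne c)
  consLow-canonical x (y ∷ h0) [] lx (hi , _) = [] , inj₂ (last (λ ()) (lx ∷ []) hi)
  consLow-canonical x (y ∷ h0) (_ ∷ _) lx (hi , inj₁ ())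
  consLow-canonical x (y ∷ h0) (_ ∷ _) lx (hi , inj₂ c) = [] , inj₂ (cons (λ ()) (lx ∷ []) hi (λ ()) c)

  toRuns-canonical : (w : List ℕ) → Canonical′ (toRuns w)
  toRuns-canonical [] = [] , inj₁ refl
  toRuns-canonical (x ∷ w) with toRuns w | toRuns-canonical w
  ... | (h0 , ps) | c with k <ᵇ x in eq
  ...   | true = (eq ∷ proj₁ c) , proj₂ c
  ...   | false = consLow-canonical x h0 ps eq c

  toRuns-high-++ : (h R : List ℕ) → High h → toRuns (h ++ R) ≡ (h ++ proj₁ (toRuns R) , proj₂ (toRuns R))
  toRuns-high-++ [] R _ = refl
  toRuns-high-++ (x ∷ h) R (hx ∷ hh) rewrite toRuns-high-++ h R hh | hx = refl

  toRuns-low-++ : (l R h : List ℕ) (ps : List (List ℕ × List ℕ)) → l ≢ [] → Low l → (h ≢ [] ⊎ ps ≡ []) →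
    toRuns R ≡ (h , ps) → toRuns (l ++ R) ≡ ([] , (l , h) ∷ ps)
  toRuns-low-++ [] R h ps ne _ _ _ = ⊥-elim (ne refl)
  toRuns-low-++ (x ∷ []) R [] ps _ (lx ∷ _) (inj₁ hne) e = ⊥-elim (hne refl)
  toRuns-low-++ (x ∷ []) R [] .[] _ (lx ∷ _) (inj₂ refl) e rewrite e | lx = refl
  toRuns-low-++ (x ∷ []) R (y ∷ h) ps _ (lx ∷ _) _ e rewrite e | lx = refl
  toRuns-low-++ (x ∷ y ∷ l) R h ps _ (lx ∷ ll) c e rewrite toRuns-low-++ (y ∷ l) R h ps (λ ()) ll c e | lx = refl

  toRuns-interleave : (h0 : List ℕ) (ps : List (List ℕ × List ℕ)) → Canonical′ (h0 , ps)
      → toRuns (interleave h0 ps) ≡ (h0 , ps)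
  toRuns-interleave h0 [] (hi , _) = trans (cong toRuns (sym (++-identityʳ h0)))
      (trans (toRuns-high-++ h0 [] hi) (cong (_, []) (++-identityʳ h0)))
  toRuns-interleave h0 (_ ∷ _) (hi , inj₁ ())
  toRuns-interleave h0 ((l , h) ∷ []) (hi , inj₂ (last ne lo hh)) =
    trans (toRuns-high-++ h0 (l ++ h) hi)
    (trans (cong (λ z → (h0 ++ proj₁ z , proj₂ z))
        (toRuns-low-++ l h h [] ne lo (inj₂ refl) (toRuns-interleave h [] (hh , inj₁ refl))))
     (cong (_, ((l , h) ∷ [])) (++-identityʳ h0)))
  toRuns-interleave h0 ((l , h) ∷ ps) (hi , inj₂ (cons ne lo hh hne c)) =
    trans (toRuns-high-++ h0 (l ++ interleave h ps) hi)
    (trans (cong (λ z → (h0 ++ proj₁ z , proj₂ z))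
        (toRuns-low-++ l (interleave h ps) h ps ne lo (inj₁ hne) (toRuns-interleave h ps (hh , inj₂ c))))
     (cong (_, ((l , h) ∷ ps)) (++-identityʳ h0)))

  lower : List ℕ → List ℕ
  lower = map (_∸ k)

  raise : List ℕ → List ℕ
  raise = map (_+ k)

  lowerHigh : List ℕ × List ℕ → List ℕ
  lowerHigh q = lower (proj₂ q)

  lowWord : Runs → List ℕ
  lowWord (h0 , ps) = joinWith (suc k) (map proj₁ ps)

  highWord : Runs → List ℕ
  highWord (h0 , ps) = joinWith 0 (lower h0 ∷ map lowerHigh ps)

  fromWords : List ℕ → List ℕ → Runs
  fromWords u v = (raise (proj₁ (breakOn 0 v)) , zip (splitOn (suc k) u) (map raise (proj₂ (breakOn 0 v))))

  low-avoids : (l : List ℕ) → Low l → Avoids (suc k) l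
  low-avoids [] [] = []
  low-avoids (x ∷ l) (lx ∷ ll) = (λ e → <⇒≱ (subst (k <_) (sym e) ≤-refl) (<ᵇ-false⁻ lx)) ∷ low-avoids l ll

  lower-avoids : (h : List ℕ) → High h → Avoids 0 (lower h)
  lower-avoids [] [] = []
  lower-avoids (x ∷ h) (hx ∷ hh) = (λ e → <⇒≱ (<ᵇ-true⁻ {k} {x} hx) (m∸n≡0⇒m≤n {x} {k} e)) ∷ lower-avoids h hh

  raise-lower : (h : List ℕ) → High h → raise (lower h) ≡ h
  raise-lower [] [] = refl
  raise-lower (x ∷ h) (hx ∷ hh) = cong₂ _∷_ (m∸n+n≡m (<⇒≤ (<ᵇ-true⁻ hx))) (raise-lower h hh)

  lower-raise : (h : List ℕ) → lower (raise h) ≡ h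
  lower-raise [] = refl
  lower-raise (x ∷ h) = cong₂ _∷_ (m+n∸n≡m x k) (lower-raise h)

  alternating-lows-avoid : (ps : List (List ℕ × List ℕ)) → Alternating ps → All (Avoids (suc k)) (map proj₁ ps)
  alternating-lows-avoid _ (last _ lo _) = low-avoids _ lo ∷ []
  alternating-lows-avoid _ (cons _ lo _ _ c) = low-avoids _ lo ∷ alternating-lows-avoid _ c

  alternating-highs-avoid : (ps : List (List ℕ × List ℕ)) → Alternating ps → All (Avoids 0) (map lowerHigh ps)
  alternating-highs-avoid _ (last _ _ hi) = lower-avoids _ hi ∷ []
  alternating-highs-avoid _ (cons _ _ hi _ c) = lower-avoids _ hi ∷ alternating-highs-avoid _ c

  zip-alternating : (ps : List (List ℕ × List ℕ)) → Alternating ps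
      → zip (map proj₁ ps) (map raise (map lowerHigh ps)) ≡ ps
  zip-alternating _ (last {l} {h} _ _ hi) = cong (λ z → (l , z) ∷ []) (raise-lower h hi)
  zip-alternating _ (cons {l} {h} _ _ hi _ c) = cong₂ (λ z r → (l , z) ∷ r) (raise-lower h hi) (zip-alternating _ c)

  fromWords-lowWord-highWord : (s : Runs) → Canonical s → fromWords (lowWord s) (highWord s) ≡ s
  fromWords-lowWord-highWord (h0 , ps@((l , h) ∷ ps')) (hi , c) = cong₂ _,_ e1 e2
    where
    eV : splitOn 0 (highWord (h0 , ps)) ≡ lower h0 ∷ map lowerHigh ps
    eV = splitOn-joinWith 0 (lower h0) (map lowerHigh ps) (lower-avoids h0 hi) (alternating-highs-avoid ps c)
    eV' : breakOn 0 (highWord (h0 , ps)) ≡ (lower h0 , map lowerHigh ps)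
    eV' = cong uncons {x = splitOn 0 (highWord (h0 , ps))} eV
    eU : splitOn (suc k) (lowWord (h0 , ps)) ≡ map proj₁ ps
    eU with alternating-lows-avoid ps c
    ... | nl ∷ nls = splitOn-joinWith (suc k) l (map proj₁ ps') nl nls
    e1 : raise (proj₁ (breakOn 0 (highWord (h0 , ps)))) ≡ h0
    e1 = trans (cong (λ z → raise (proj₁ z)) eV') (raise-lower h0 hi)
    e2 : zip (splitOn (suc k) (lowWord (h0 , ps))) (map raise (proj₂ (breakOn 0 (highWord (h0 , ps))))) ≡ ps
    e2 = trans (cong₂ (λ a b → zip a (map raise (proj₂ b))) eU eV') (zip-alternating ps c)

  map-lower-zip : (xs : List (List ℕ)) (ys : List (List ℕ)) → length xs ≡ length ys →
    map lowerHigh (zip xs (map raise ys)) ≡ ys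
  map-lower-zip [] [] _ = refl
  map-lower-zip (x ∷ xs) (y ∷ ys) e = cong₂ _∷_ (lower-raise y) (map-lower-zip xs ys (suc-injective e))

  lowWord-fromWords : (u v : List ℕ) → length (splitOn (suc k) u) ≡ length (proj₂ (breakOn 0 v))
      → lowWord (fromWords u v) ≡ u
  lowWord-fromWords u v e = trans
      (cong (joinWith (suc k)) (map-proj₁-zip (splitOn (suc k) u) (map raise (proj₂ (breakOn 0 v)))
      (trans e (sym (length-map raise (proj₂ (breakOn 0 v)))))))
                    (joinWith-splitOn (suc k) u)

  highWord-fromWords : (u v : List ℕ) → length (splitOn (suc k) u) ≡ length (proj₂ (breakOn 0 v))
      → highWord (fromWords u v) ≡ v
  highWord-fromWords u v e = trans
      (cong₂ (λ a b → joinWith 0 (a ∷ b)) (lower-raise (proj₁ (breakOn 0 v)))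
      (map-lower-zip (splitOn (suc k) u) (proj₂ (breakOn 0 v)) e)) (joinWith-splitOn 0 v)

  keepLow : ℕ∞ → Maybe ℕ
  keepLow (fin y) = if k <ᵇ y then nothing else just y
  keepLow ∞ = nothing

  keepLowℕ : ℕ → Maybe ℕ
  keepLowℕ y = keepLow (fin y)

  keepLow-high : (h : List ℕ) → High h → AllNothing (map keepLowℕ h)
  keepLow-high [] [] = []
  keepLow-high (x ∷ h) (hx ∷ hh) rewrite hx = refl ∷ keepLow-high h hh

  keepLow-low : (l : List ℕ) → Low l → map keepLowℕ l ≡ map just l
  keepLow-low [] [] = refl
  keepLow-low (x ∷ l) (lx ∷ ll) rewrite lx = cong (just x ∷_) (keepLow-low l ll)

  collapsedLows : List (List ℕ) → List (Maybe ℕ)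
  collapsedLows [] = [ nothing ]
  collapsedLows (l ∷ []) = map just l ++ [ nothing ]
  collapsedLows (l ∷ l' ∷ ls) = map just l ++ (nothing ∷ collapsedLows (l' ∷ ls))

  collapse-keepLow-interleave : (h0 : List ℕ) (ps : List (List ℕ × List ℕ)) → High h0 → Alternating ps →
    collapse′ (map keepLowℕ (interleave h0 ps) ++ [ nothing ]) ≡ collapsedLows (map proj₁ ps)
  collapse-keepLow-interleave h0 ((l , h) ∷ []) hi (last ne lo hh) = begin
    collapse′ (map keepLowℕ (interleave h0 ((l , h) ∷ [])) ++ [ nothing ])
        ≡⟨ cong collapse′ (map-interleave-∷ keepLowℕ h0 l h [] [ nothing ]) ⟩
    collapse′ (map keepLowℕ h0 ++ (map keepLowℕ l ++ (map keepLowℕ h ++ [ nothing ])))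
        ≡⟨ collapse′-nothings (map keepLowℕ h0) _ (keepLow-high h0 hi) ⟩
    collapse′ (map keepLowℕ l ++ (map keepLowℕ h ++ [ nothing ]))
        ≡⟨ cong (λ z → collapse′ (z ++ (map keepLowℕ h ++ [ nothing ]))) (keepLow-low l lo) ⟩
    collapse′ (map just l ++ (map keepLowℕ h ++ [ nothing ])) ≡⟨ collapse′-justs l _ ne ⟩
    map just l ++ collapse (map keepLowℕ h ++ [ nothing ]) ≡⟨ cong (map just l ++_) (lastN h hh) ⟩
    map just l ++ [ nothing ] ∎
    where
    open ≡-Reasoning
    lastN : (h : List ℕ) → High h → collapse (map keepLowℕ h ++ [ nothing ]) ≡ [ nothing ]
    lastN [] _ = refl
    lastN (x ∷ h) (hx ∷ hh) rewrite hx = cong (nothing ∷_)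
        (collapse′-nothings (map keepLowℕ h) [ nothing ] (keepLow-high h hh))
  collapse-keepLow-interleave h0 ((l , h) ∷ (l' , h') ∷ ps) hi (cons ne lo hh hne c) = begin
    collapse′ (map keepLowℕ (interleave h0 ((l , h) ∷ (l' , h') ∷ ps)) ++ [ nothing ])
        ≡⟨ cong collapse′ (map-interleave-∷ keepLowℕ h0 l h ((l' , h') ∷ ps) [ nothing ]) ⟩
    collapse′ (map keepLowℕ h0 ++ (map keepLowℕ l ++ (map keepLowℕ (interleave h ((l' , h') ∷ ps)) ++ [ nothing ])))
        ≡⟨ collapse′-nothings (map keepLowℕ h0) _ (keepLow-high h0 hi) ⟩
    collapse′ (map keepLowℕ l ++ (map keepLowℕ (interleave h ((l' , h') ∷ ps)) ++ [ nothing ]))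
        ≡⟨ cong (λ z → collapse′ (z ++ _)) (keepLow-low l lo) ⟩
    collapse′ (map just l ++ (map keepLowℕ (interleave h ((l' , h') ∷ ps)) ++ [ nothing ]))
        ≡⟨ collapse′-justs l _ ne ⟩
    map just l ++ collapse (map keepLowℕ (interleave h ((l' , h') ∷ ps)) ++ [ nothing ])
        ≡⟨ cong (λ z → map just l ++ collapse z) (map-interleave-∷ keepLowℕ h l' h' ps [ nothing ]) ⟩
    map just l ++ collapse (map keepLowℕ h ++ (map keepLowℕ l' ++ (map keepLowℕ (interleave h' ps) ++ [ nothing ])))
        ≡⟨ cong (map just l ++_) (collapse-nothings (map keepLowℕ h) _ (λ e → hne (map-nil h e))
        (keepLow-high h hh)) ⟩
    map just l ++ (nothing ∷ collapse′ (map keepLowℕ l' ++ (map keepLowℕ (interleave h' ps) ++ [ nothing ])))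
        ≡⟨ cong (λ z → map just l ++ (nothing ∷ z))
        (sym (cong collapse′ (map-interleave-∷ keepLowℕ [] l' h' ps [ nothing ]))) ⟩
    map just l ++ (nothing ∷ collapse′ (map keepLowℕ (interleave [] ((l' , h') ∷ ps)) ++ [ nothing ]))
        ≡⟨ cong (λ z → map just l ++ (nothing ∷ z)) (collapse-keepLow-interleave [] ((l' , h') ∷ ps) [] c) ⟩
    map just l ++ (nothing ∷ collapsedLows (l' ∷ map proj₁ ps)) ∎
    where
    open ≡-Reasoning
    map-nil : (h : List ℕ) → map keepLowℕ h ≡ [] → h ≡ []
    map-nil [] _ = refl

  LowPieces : List (List ℕ) → Set
  LowPieces = All (λ l → (l ≢ []) × Low l)

  keepLow-top : keepLowℕ (suc k) ≡ nothing
  keepLow-top rewrite <ᵇ-true (n<1+n k) = refl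

  collapse-keepLow-joinWith : (ls : List (List ℕ)) → ls ≢ [] → LowPieces ls
      → collapse′ (map keepLowℕ (joinWith (suc k) ls) ++ [ nothing ]) ≡ collapsedLows ls
  collapse-keepLow-joinWith [] ne _ = ⊥-elim (ne refl)
  collapse-keepLow-joinWith (l ∷ []) _ ((lne , lo) ∷ []) = begin
    collapse′ (map keepLowℕ l ++ [ nothing ]) ≡⟨ cong (λ z → collapse′ (z ++ [ nothing ])) (keepLow-low l lo) ⟩
    collapse′ (map just l ++ [ nothing ]) ≡⟨ collapse′-justs l _ lne ⟩
    map just l ++ [ nothing ] ∎
    where open ≡-Reasoning
  collapse-keepLow-joinWith (l ∷ l' ∷ ls) _ ((lne , lo) ∷ rest) = begin
    collapse′ (map keepLowℕ (l ++ (suc k ∷ joinWith (suc k) (l' ∷ ls))) ++ [ nothing ])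
        ≡⟨ cong (λ z → collapse′ (z ++ [ nothing ])) (map-++ keepLowℕ l _) ⟩
    collapse′ ((map keepLowℕ l ++ map keepLowℕ (suc k ∷ joinWith (suc k) (l' ∷ ls))) ++ [ nothing ])
        ≡⟨ cong collapse′ (++-assoc (map keepLowℕ l) _ _) ⟩
    collapse′ (map keepLowℕ l ++ (map keepLowℕ (suc k ∷ joinWith (suc k) (l' ∷ ls)) ++ [ nothing ]))
        ≡⟨ cong (λ z → collapse′ (z ++ _)) (keepLow-low l lo) ⟩
    collapse′ (map just l ++ (map keepLowℕ (suc k ∷ joinWith (suc k) (l' ∷ ls)) ++ [ nothing ]))
        ≡⟨ collapse′-justs l _ lne ⟩
    map just l ++ collapse (keepLowℕ (suc k) ∷ (map keepLowℕ (joinWith (suc k) (l' ∷ ls)) ++ [ nothing ]))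
        ≡⟨ cong (λ z → map just l ++ collapse
        (z ∷ (map keepLowℕ (joinWith (suc k) (l' ∷ ls)) ++ [ nothing ]))) keepLow-top ⟩
    map just l ++ (nothing ∷ collapse′ (map keepLowℕ (joinWith (suc k) (l' ∷ ls)) ++ [ nothing ]))
        ≡⟨ cong (λ z → map just l ++ (nothing ∷ z)) (collapse-keepLow-joinWith (l' ∷ ls) (λ ()) rest) ⟩
    map just l ++ (nothing ∷ collapsedLows (l' ∷ ls)) ∎
    where open ≡-Reasoning

  alternating-lowPieces : (ps : List (List ℕ × List ℕ)) → Alternating ps → LowPieces (map proj₁ ps)
  alternating-lowPieces _ (last ne lo _) = (ne , lo) ∷ []
  alternating-lowPieces _ (cons ne lo _ _ c) = (ne , lo) ∷ alternating-lowPieces _ c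

  alternating-nonEmpty : (ps : List (List ℕ × List ℕ)) → Alternating ps → map proj₁ ps ≢ []
  alternating-nonEmpty _ (last _ _ _) ()
  alternating-nonEmpty _ (cons _ _ _ _ _) ()

  collapse-keepLow-lowWord : (s : Runs) → Canonical s → collapse (map keepLow (framed (flatten s)))
      ≡ collapse (map keepLow (framed (lowWord s)))
  collapse-keepLow-lowWord (h0 , ps) (hi , c) = begin
    collapse (map keepLow (framed (interleave h0 ps))) ≡⟨ cong collapse (map-framed keepLow (interleave h0 ps)) ⟩
    nothing ∷ collapse′ (map keepLowℕ (interleave h0 ps) ++ [ nothing ])
        ≡⟨ cong (nothing ∷_) (collapse-keepLow-interleave h0 ps hi c) ⟩
    nothing ∷ collapsedLows (map proj₁ ps)
        ≡⟨ cong (nothing ∷_) (sym (collapse-keepLow-joinWith (map proj₁ ps) (alternating-nonEmpty ps c)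
        (alternating-lowPieces ps c))) ⟩
    nothing ∷ collapse′ (map keepLowℕ (joinWith (suc k) (map proj₁ ps)) ++ [ nothing ])
        ≡⟨ sym (cong collapse (map-framed keepLow (joinWith (suc k) (map proj₁ ps)))) ⟩
    collapse (map keepLow (framed (lowWord (h0 , ps)))) ∎
    where open ≡-Reasoning

  keepHigh : ℕ → ℕ∞ → Maybe ℕ∞
  keepHigh k' (fin y) = if k' <ᵇ y then just (fin (y ∸ k')) else nothing
  keepHigh k' ∞ = just ∞

  keepHighℕ : ℕ → Maybe ℕ∞
  keepHighℕ y = keepHigh k (fin y)

  keepPositiveℕ : ℕ → Maybe ℕ∞
  keepPositiveℕ y = keepHigh 0 (fin y)

  justFins : List ℕ → List (Maybe ℕ∞)
  justFins xs = map just (map fin xs)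

  keepHigh-high : (h : List ℕ) → High h → map keepHighℕ h ≡ justFins (lower h)
  keepHigh-high [] [] = refl
  keepHigh-high (x ∷ h) (hx ∷ hh) rewrite hx = cong (just (fin (x ∸ k)) ∷_) (keepHigh-high h hh)

  keepHigh-low : (l : List ℕ) → Low l → AllNothing (map keepHighℕ l)
  keepHigh-low [] [] = []
  keepHigh-low (x ∷ l) (lx ∷ ll) rewrite lx = refl ∷ keepHigh-low l ll

  keepPositive-avoids : (xs : List ℕ) → Avoids 0 xs → map keepPositiveℕ xs ≡ justFins xs
  keepPositive-avoids [] [] = refl
  keepPositive-avoids (zero ∷ xs) (n ∷ ns) = ⊥-elim (n refl)
  keepPositive-avoids (suc x ∷ xs) (n ∷ ns) = cong (just (fin (suc x)) ∷_) (keepPositive-avoids xs ns)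

  startsJust-high : (x : ℕ) (h : List ℕ) (R : List ℕ) (S : List (Maybe ℕ∞)) → (k <ᵇ x) ≡ true
      → StartsJust (map keepHighℕ ((x ∷ h) ++ R) ++ S)
  startsJust-high x h R S hx rewrite hx = tt

  startsJust-lower : (x : ℕ) (h : List ℕ) (R : List ℕ) (S : List (Maybe ℕ∞)) → (k <ᵇ x) ≡ true
      → StartsJust (map keepPositiveℕ (lower (x ∷ h) ++ R) ++ S)
  startsJust-lower x h R S hx rewrite <ᵇ-true {0} {x ∸ k} (m<n⇒0<n∸m {k} {x} (<ᵇ-true⁻ {k} {x} hx)) = tt

  map-joinWith-∷ : (a b : List ℕ) (r : List (List ℕ)) → map keepPositiveℕ (joinWith 0 (a ∷ b ∷ r)) ++ [ just ∞ ]
      ≡ map keepPositiveℕ a ++ (keepPositiveℕ 0 ∷ (map keepPositiveℕ (joinWith 0 (b ∷ r)) ++ [ just ∞ ]))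
  map-joinWith-∷ a b r = trans (cong (_++ [ just ∞ ]) (map-++ keepPositiveℕ a (0 ∷ joinWith 0 (b ∷ r))))
      (++-assoc (map keepPositiveℕ a) _ [ just ∞ ])

  collapse-keepHigh-interleave : (h0 : List ℕ) (ps : List (List ℕ × List ℕ)) → High h0 → (ps ≡ [] ⊎ Alternating ps) →
    collapse (map keepHighℕ (interleave h0 ps) ++ [ just ∞ ])
        ≡ collapse (map keepPositiveℕ (joinWith 0 (lower h0 ∷ map lowerHigh ps)) ++ [ just ∞ ])
  collapse-keepHigh-interleave h0 [] hi _ = cong (λ z → collapse (z ++ [ just ∞ ]))
      (trans (keepHigh-high h0 hi) (sym (keepPositive-avoids (lower h0) (lower-avoids h0 hi))))
  collapse-keepHigh-interleave h0 (_ ∷ _) hi (inj₁ ())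
  collapse-keepHigh-interleave h0 ((l , h) ∷ []) hi (inj₂ (last ne lo hh)) = begin
    collapse (map keepHighℕ (interleave h0 ((l , h) ∷ [])) ++ [ just ∞ ])
        ≡⟨ cong collapse (map-interleave-∷ keepHighℕ h0 l h [] [ just ∞ ]) ⟩
    collapse (map keepHighℕ h0 ++ (map keepHighℕ l ++ (map keepHighℕ h ++ [ just ∞ ])))
        ≡⟨ cong (λ z → collapse (z ++ _)) (keepHigh-high h0 hi) ⟩
    collapse (justFins (lower h0) ++ (map keepHighℕ l ++ (map keepHighℕ h ++ [ just ∞ ])))
        ≡⟨ collapse-justs (map fin (lower h0)) _ ⟩
    justFins (lower h0) ++ collapse (map keepHighℕ l ++ (map keepHighℕ h ++ [ just ∞ ]))
        ≡⟨ cong (justFins (lower h0) ++_)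
        (collapse-nothings (map keepHighℕ l) _ (λ e → ne (mapnil l e)) (keepHigh-low l lo)) ⟩
    justFins (lower h0) ++ (nothing ∷ collapse′ (map keepHighℕ h ++ [ just ∞ ]))
        ≡⟨ cong (λ z → justFins (lower h0) ++ (nothing ∷ collapse′ (z ++ [ just ∞ ])))
        (trans (keepHigh-high h hh) (sym (keepPositive-avoids (lower h) (lower-avoids h hh)))) ⟩
    justFins (lower h0) ++ (nothing ∷ collapse′ (map keepPositiveℕ (lower h) ++ [ just ∞ ]))
        ≡⟨ sym (collapse-justs (map fin (lower h0)) _) ⟩
    collapse (justFins (lower h0) ++ (nothing ∷ (map keepPositiveℕ (lower h) ++ [ just ∞ ])))
        ≡⟨ cong (λ z → collapse (z ++ (nothing ∷ (map keepPositiveℕ (lower h) ++ [ just ∞ ]))))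
        (sym (keepPositive-avoids (lower h0) (lower-avoids h0 hi))) ⟩
    collapse (map keepPositiveℕ (lower h0) ++ (keepPositiveℕ 0 ∷ (map keepPositiveℕ (lower h) ++ [ just ∞ ])))
        ≡⟨ cong collapse (sym (map-joinWith-∷ (lower h0) (lower h) [])) ⟩
    collapse (map keepPositiveℕ (joinWith 0 (lower h0 ∷ lower h ∷ [])) ++ [ just ∞ ]) ∎
    where
    open ≡-Reasoning
    mapnil : (l : List ℕ) → map keepHighℕ l ≡ [] → l ≡ []
    mapnil [] _ = refl
  collapse-keepHigh-interleave h0 ((l , []) ∷ ps) hi (inj₂ (cons ne lo hh hne c)) = ⊥-elim (hne refl)
  collapse-keepHigh-interleave h0 ((l , (x ∷ hr)) ∷ ((l' , h') ∷ ps')) hi (inj₂ (cons ne lo (hx ∷ hh) hne c)) = begin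
    collapse (map keepHighℕ (interleave h0 ((l , h) ∷ ps)) ++ [ just ∞ ])
        ≡⟨ cong collapse (map-interleave-∷ keepHighℕ h0 l h ps [ just ∞ ]) ⟩
    collapse (map keepHighℕ h0 ++ (map keepHighℕ l ++ ZL))
        ≡⟨ cong (λ z → collapse (z ++ (map keepHighℕ l ++ ZL))) (keepHigh-high h0 hi) ⟩
    collapse (justFins (lower h0) ++ (map keepHighℕ l ++ ZL)) ≡⟨ collapse-justs (map fin (lower h0)) _ ⟩
    justFins (lower h0) ++ collapse (map keepHighℕ l ++ ZL)
        ≡⟨ cong (justFins (lower h0) ++_)
        (collapse-nothings (map keepHighℕ l) _ (λ e → ne (mapnil l e)) (keepHigh-low l lo)) ⟩
    justFins (lower h0) ++ (nothing ∷ collapse′ ZL)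
        ≡⟨ cong (λ z → justFins (lower h0) ++ (nothing ∷ z))
        (collapse′-startsJust ZL (startsJust-high x hr (l' ++ interleave h' ps') [ just ∞ ] hx)) ⟩
    justFins (lower h0) ++ (nothing ∷ collapse ZL)
        ≡⟨ cong (λ z → justFins (lower h0) ++ (nothing ∷ z)) (collapse-keepHigh-interleave h ps (hx ∷ hh) (inj₂ c)) ⟩
    justFins (lower h0) ++ (nothing ∷ collapse ZR)
        ≡⟨ cong (λ z → justFins (lower h0) ++ (nothing ∷ z))
        (sym (collapse′-startsJust ZR (startsJust-lower x hr (0 ∷ joinWith 0 (map lowerHigh ps)) [ just ∞ ] hx))) ⟩
    justFins (lower h0) ++ (nothing ∷ collapse′ ZR) ≡⟨ sym (collapse-justs (map fin (lower h0)) _) ⟩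
    collapse (justFins (lower h0) ++ (nothing ∷ ZR))
        ≡⟨ cong (λ z → collapse (z ++ (nothing ∷ ZR))) (sym (keepPositive-avoids (lower h0) (lower-avoids h0 hi))) ⟩
    collapse (map keepPositiveℕ (lower h0) ++ (keepPositiveℕ 0 ∷ ZR))
        ≡⟨ cong collapse (sym (map-joinWith-∷ (lower h0) (lower h) (map lowerHigh ps))) ⟩
    collapse (map keepPositiveℕ (joinWith 0 (lower h0 ∷ lower h ∷ map lowerHigh ps)) ++ [ just ∞ ]) ∎
    where
    open ≡-Reasoning
    h = x ∷ hr
    ps = (l' , h') ∷ ps'
    ZL = map keepHighℕ (interleave h ps) ++ [ just ∞ ]
    ZR = map keepPositiveℕ (joinWith 0 (lower h ∷ map lowerHigh ps)) ++ [ just ∞ ]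
    mapnil : (l : List ℕ) → map keepHighℕ l ≡ [] → l ≡ []
    mapnil [] _ = refl

  collapse-keepHigh-highWord : (s : Runs) → Canonical s → collapse (map (keepHigh k) (framed (flatten s)))
      ≡ collapse (map (keepHigh 0) (framed (highWord s)))
  collapse-keepHigh-highWord (h0 , ps) (hi , c) = begin
    collapse (map (keepHigh k) (framed (interleave h0 ps)))
        ≡⟨ cong collapse (map-framed (keepHigh k) (interleave h0 ps)) ⟩
    just ∞ ∷ collapse (map keepHighℕ (interleave h0 ps) ++ [ just ∞ ])
        ≡⟨ cong (just ∞ ∷_) (collapse-keepHigh-interleave h0 ps hi (inj₂ c)) ⟩
    just ∞ ∷ collapse (map keepPositiveℕ (joinWith 0 (lower h0 ∷ map lowerHigh ps)) ++ [ just ∞ ])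
        ≡⟨ sym (cong collapse (map-framed (keepHigh 0) (highWord (h0 , ps)))) ⟩
    collapse (map (keepHigh 0) (framed (highWord (h0 , ps)))) ∎
    where open ≡-Reasoning

  ∧-cong-if : ∀ {b b' r r'} → b ≡ b' → (b ≡ true → r ≡ r') → b ∧ r ≡ b' ∧ r'
  ∧-cong-if {false} refl f = refl
  ∧-cong-if {true} refl f = cong (true ∧_) (f refl)

  isJustℕ : ℕ → Maybe ℕ → Bool
  isJustℕ c (just y) = y ≡ᵇ c
  isJustℕ c nothing = false

  belowᵇ : Maybe ℕ → ℕ → Bool
  belowᵇ nothing c = false
  belowᵇ (just z) c = z <ᵇ c

  isPinnacleLow : ℕ → Triple (Maybe ℕ) → Bool
  isPinnacleLow c (a , b , d) = isJustℕ c b ∧ (belowᵇ a c ∧ belowᵇ d c)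

  positiveᵇ : Maybe ℕ → Bool
  positiveᵇ nothing = true
  positiveᵇ (just z) = 0 <ᵇ z

  isBadZeroLow : Triple (Maybe ℕ) → Bool
  isBadZeroLow (a , b , d) = isJustℕ 0 b ∧ not (positiveᵇ a ∧ positiveᵇ d)

  isFin-keepLow : (c : ℕ) (y : ℕ∞) → c ≤ k → isFin c y ≡ isJustℕ c (keepLow y)
  isFin-keepLow c ∞ _ = refl
  isFin-keepLow c (fin y) c≤k with k <ᵇ y in e
  ... | true = ≡ᵇ-false {y} {c} (λ y≡c → <⇒≱ (<ᵇ-true⁻ {k} {y} e) (subst (_≤ k) (sym y≡c) c≤k))
  ... | false = refl

  <ᵇ∞-keepLow : (c : ℕ) (x : ℕ∞) → c ≤ k → (x <ᵇ∞ fin c) ≡ belowᵇ (keepLow x) c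
  <ᵇ∞-keepLow c ∞ _ = refl
  <ᵇ∞-keepLow c (fin x) c≤k with k <ᵇ x in e
  ... | true = <ᵇ-false {x} {c} (≤-trans c≤k (<⇒≤ (<ᵇ-true⁻ {k} {x} e)))
  ... | false = refl

  0<ᵇ∞-keepLow : (x : ℕ∞) → (fin 0 <ᵇ∞ x) ≡ positiveᵇ (keepLow x)
  0<ᵇ∞-keepLow ∞ = refl
  0<ᵇ∞-keepLow (fin x) with k <ᵇ x in e
  ... | true = <ᵇ-true {0} {x} (≤-trans (s≤s z≤n) (<ᵇ-true⁻ {k} {x} e))
  ... | false = refl

  isFin-true⁻ : (c : ℕ) (y : ℕ∞) → isFin c y ≡ true → y ≡ fin c
  isFin-true⁻ c (fin y) e = cong fin (≡ᵇ-true⁻ e)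

  isPinnacle-keepLow : (c : ℕ) → c ≤ k → (T : Triple ℕ∞) → isPinnacle c T ≡ isPinnacleLow c (mapTriple keepLow T)
  isPinnacle-keepLow c c≤k (x , y , z) = ∧-cong-if (isFin-keepLow c y c≤k) λ e →
    subst (λ y → ((x <ᵇ∞ y) ∧ (z <ᵇ∞ y)) ≡ (belowᵇ (keepLow x) c ∧ belowᵇ (keepLow z) c)) (sym (isFin-true⁻ c y e))
      (cong₂ _∧_ (<ᵇ∞-keepLow c x c≤k) (<ᵇ∞-keepLow c z c≤k))

  middle-keepLow : (c : ℕ) → c ≤ k → (T : Triple ℕ∞) → isFin c (middle T) ≡ isJustℕ c (middle (mapTriple keepLow T))
  middle-keepLow c c≤k (x , y , z) = isFin-keepLow c y c≤k

  isBadZero-keepLow : (T : Triple ℕ∞) → isBadZero T ≡ isBadZeroLow (mapTriple keepLow T)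
  isBadZero-keepLow (x , y , z) = ∧-cong-if (isFin-keepLow 0 y z≤n) λ _
      → cong not (cong₂ _∧_ (0<ᵇ∞-keepLow x) (0<ᵇ∞-keepLow z))

  isJustFin : ℕ → Maybe ℕ∞ → Bool
  isJustFin c (just (fin y)) = y ≡ᵇ c
  isJustFin c (just ∞) = false
  isJustFin c nothing = false

  belowHighᵇ : Maybe ℕ∞ → ℕ → Bool
  belowHighᵇ nothing c = true
  belowHighᵇ (just (fin z)) c = z <ᵇ c
  belowHighᵇ (just ∞) c = false

  isPinnacleHigh : ℕ → Triple (Maybe ℕ∞) → Bool
  isPinnacleHigh c (a , b , d) = isJustFin c b ∧ (belowHighᵇ a c ∧ belowHighᵇ d c)

  isFin-keepHigh : (k' c : ℕ) (y : ℕ∞) → 1 ≤ c → isFin (c + k') y ≡ isJustFin c (keepHigh k' y)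
  isFin-keepHigh k' c ∞ _ = refl
  isFin-keepHigh k' c (fin y) 1≤c with k' <ᵇ y in e
  ... | false = ≡ᵇ-false {y} {c + k'}
      (λ y≡ → <⇒≱ (subst (k' <_) (sym y≡) (subst (_≤ c + k') (+-identityˡ (suc k')) (+-monoˡ-≤ k' 1≤c)))
      (<ᵇ-false⁻ {k'} {y} e))
  ... | true = truth-ext (λ t → ≡ᵇ-true {y ∸ k'} {c} (trans (cong (_∸ k') (≡ᵇ-true⁻ {y} {c + k'} t)) (m+n∸n≡m c k')))
                       (λ t → ≡ᵇ-true {y} {c + k'} (trans (sym (m∸n+n≡m (<⇒≤ (<ᵇ-true⁻ {k'} {y} e))))
                           (cong (_+ k') (≡ᵇ-true⁻ {y ∸ k'} {c} t))))

  <ᵇ∞-keepHigh : (k' c : ℕ) (x : ℕ∞) → 1 ≤ c → (x <ᵇ∞ fin (c + k')) ≡ belowHighᵇ (keepHigh k' x) c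
  <ᵇ∞-keepHigh k' c ∞ _ = refl
  <ᵇ∞-keepHigh k' c (fin x) 1≤c with k' <ᵇ x in e
  ... | false = <ᵇ-true {x} {c + k'}
      (≤-trans (s≤s (<ᵇ-false⁻ {k'} {x} e)) (subst (_≤ c + k') (+-identityˡ (suc k')) (+-monoˡ-≤ k' 1≤c)))
  ... | true = truth-ext (λ t → <ᵇ-true {x ∸ k'} {c}
      (+-cancelʳ-< k' (x ∸ k') c (subst (_< c + k') (sym (m∸n+n≡m (<⇒≤ (<ᵇ-true⁻ {k'} {x} e))))
      (<ᵇ-true⁻ {x} {c + k'} t))))
                       (λ t → <ᵇ-true {x} {c + k'} (subst (_< c + k') (m∸n+n≡m (<⇒≤ (<ᵇ-true⁻ {k'} {x} e)))
                           (+-monoˡ-< k' (<ᵇ-true⁻ {x ∸ k'} {c} t))))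

  isPinnacle-keepHigh : (k' c : ℕ) → 1 ≤ c → (T : Triple ℕ∞) → isPinnacle (c + k') T
      ≡ isPinnacleHigh c (mapTriple (keepHigh k') T)
  isPinnacle-keepHigh k' c 1≤c (x , y , z) = ∧-cong-if (isFin-keepHigh k' c y 1≤c) λ e →
    subst (λ y → ((x <ᵇ∞ y) ∧ (z <ᵇ∞ y)) ≡ (belowHighᵇ (keepHigh k' x) c ∧ belowHighᵇ (keepHigh k' z) c))
        (sym (isFin-true⁻ (c + k') y e))
      (cong₂ _∧_ (<ᵇ∞-keepHigh k' c x 1≤c) (<ᵇ∞-keepHigh k' c z 1≤c))

  middle-keepHigh : (k' c : ℕ) → 1 ≤ c → (T : Triple ℕ∞) → isFin (c + k') (middle T)
      ≡ isJustFin c (middle (mapTriple (keepHigh k') T))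
  middle-keepHigh k' c 1≤c (x , y , z) = isFin-keepHigh k' c y 1≤c

  isPinnacle-keepPositive : (c : ℕ) → 1 ≤ c → (T : Triple ℕ∞) → isPinnacle c T
      ≡ isPinnacleHigh c (mapTriple (keepHigh 0) T)
  isPinnacle-keepPositive c 1≤c T = subst (λ q → isPinnacle q T ≡ isPinnacleHigh c (mapTriple (keepHigh 0) T))
      (+-identityʳ c) (isPinnacle-keepHigh 0 c 1≤c T)

  middle-keepPositive : (c : ℕ) → 1 ≤ c → (T : Triple ℕ∞) → isFin c (middle T)
      ≡ isJustFin c (middle (mapTriple (keepHigh 0) T))
  middle-keepPositive c 1≤c T = subst (λ q → isFin q (middle T) ≡ isJustFin c (middle (mapTriple (keepHigh 0) T)))
      (+-identityʳ c) (middle-keepHigh 0 c 1≤c T)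

  low-bounded : (l : List ℕ) → Low l → All (_< suc (suc k)) l
  low-bounded l lo = All.map (λ {x} e → s≤s (≤-trans (<ᵇ-false⁻ {k} {x} e) (n≤1+n k))) lo

  alternating-lows-nonEmpty : (ps : List (List ℕ × List ℕ)) → Alternating ps → All NonEmpty (map proj₁ ps)
  alternating-lows-nonEmpty ps c = All.map proj₁ (alternating-lowPieces ps c)

  alternating-highs-initNonEmpty : (ps : List (List ℕ × List ℕ)) → Alternating ps → InitNonEmpty (map lowerHigh ps)
  alternating-highs-initNonEmpty _ (last _ _ _) = tt
  alternating-highs-initNonEmpty _ (cons {h = []} _ _ _ hne _) = ⊥-elim (hne refl)
  alternating-highs-initNonEmpty _ (cons {h = x ∷ h} _ _ _ hne (last _ _ _)) = (λ ()) , tt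
  alternating-highs-initNonEmpty _ (cons {h = x ∷ h} _ _ _ hne c@(cons _ _ _ _ _)) = (λ ()) ,
      alternating-highs-initNonEmpty _ c

  zip-alternating⁺ : (ls hs : List (List ℕ)) → length ls ≡ length hs → ls ≢ [] → All (λ l → NonEmpty l × Low l) ls
      → All High hs → InitNonEmpty hs →
    Alternating (zip ls hs)
  zip-alternating⁺ [] _ _ ne _ _ _ = ⊥-elim (ne refl)
  zip-alternating⁺ (l ∷ []) (h ∷ []) _ _ ((nl , lo) ∷ []) (hh ∷ []) _ = last nl lo hh
  zip-alternating⁺ (l ∷ l' ∷ ls) (h ∷ h' ∷ hs) e _ ((nl , lo) ∷ as) (hh ∷ hhs) (hne , nei) =
    cons nl lo hh hne (zip-alternating⁺ (l' ∷ ls) (h' ∷ hs) (suc-injective e) (λ ()) as hhs nei)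
  zip-alternating⁺ (l ∷ []) (h ∷ h' ∷ hs) () _ _ _ _
  zip-alternating⁺ (l ∷ l' ∷ ls) (h ∷ []) () _ _ _ _
  zip-alternating⁺ (l ∷ ls) [] () _ _ _ _

  raise-high : (p : List ℕ) → Avoids 0 p → High (raise p)
  raise-high [] [] = []
  raise-high (zero ∷ p) (nz ∷ _) = ⊥-elim (nz refl)
  raise-high (suc x ∷ p) (_ ∷ ns) = <ᵇ-true {k} {suc x + k}
      (subst (k <_) (sym (+-comm (suc x) k)) (m<m+n k (s≤s z≤n))) ∷ raise-high p ns

  InitNonEmpty-raise : (ps : List (List ℕ)) → InitNonEmpty ps → InitNonEmpty (map raise ps)
  InitNonEmpty-raise [] _ = tt
  InitNonEmpty-raise (p ∷ []) _ = tt
  InitNonEmpty-raise ([] ∷ p' ∷ ps) (ne , _) = ⊥-elim (ne refl)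
  InitNonEmpty-raise ((x ∷ p) ∷ p' ∷ ps) (_ , n) = (λ ()) , InitNonEmpty-raise (p' ∷ ps) n

  low-piece : (l : List ℕ) → All (_< suc (suc k)) l → Avoids (suc k) l → Low l
  low-piece [] [] [] = []
  low-piece (x ∷ l) (b ∷ bs) (n ∷ ns) = <ᵇ-false {k} {x} (le-ne' x b n) ∷ low-piece l bs ns
    where
    le-ne' : (x : ℕ) → x < suc (suc k) → x ≢ suc k → x ≤ k
    le-ne' x (s≤s b) n = ≤-pred (≤∧≢⇒< b n)

  module _ (s : Runs) (can : Canonical s) where
    private
      w = flatten s
      u = lowWord s
      v = highWord s

    occ-lowWord : (c : ℕ) → c ≤ k → occ c w ≡ occ c u
    occ-lowWord c c≤k = trans (occ≡countᵇ-middle c w) (trans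
      (countᵇ-windows-transfer (λ T → isFin c (middle T)) (λ T → isFin c (middle T)) (λ T → isJustℕ c (middle T))
          keepLow keepLow (λ _ _ → refl)
         (middle-keepLow c c≤k) (middle-keepLow c c≤k) (framed w) (framed u) (collapse-keepLow-lowWord s can))
      (sym (occ≡countᵇ-middle c u)))

    pinnacles-lowWord : (c : ℕ) → c ≤ k → pinnacleCount c w ≡ pinnacleCount c u
    pinnacles-lowWord c c≤k = countᵇ-windows-transfer (isPinnacle c) (isPinnacle c) (isPinnacleLow c) keepLow
        keepLow (λ _ _ → refl)
         (isPinnacle-keepLow c c≤k) (isPinnacle-keepLow c c≤k) (framed w) (framed u) (collapse-keepLow-lowWord s can)

    badZeros-lowWord : badZeroCount w ≡ badZeroCount u
    badZeros-lowWord = countᵇ-windows-transfer isBadZero isBadZero isBadZeroLow keepLow keepLow (λ _ _ → refl)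
        isBadZero-keepLow isBadZero-keepLow (framed w) (framed u) (collapse-keepLow-lowWord s can)

    occ-highWord : (c : ℕ) → 1 ≤ c → occ (c + k) w ≡ occ c v
    occ-highWord c 1≤c = trans (occ≡countᵇ-middle (c + k) w) (trans
      (countᵇ-windows-transfer (λ T → isFin (c + k) (middle T)) (λ T → isFin c (middle T))
          (λ T → isJustFin c (middle T)) (keepHigh k) (keepHigh 0) (λ _ _ → refl)
         (middle-keepHigh k c 1≤c) (middle-keepPositive c 1≤c) (framed w) (framed v)
             (collapse-keepHigh-highWord s can))
      (sym (occ≡countᵇ-middle c v)))

    pinnacles-highWord : (c : ℕ) → 1 ≤ c → pinnacleCount (c + k) w ≡ pinnacleCount c v
    pinnacles-highWord c 1≤c = countᵇ-windows-transfer (isPinnacle (c + k)) (isPinnacle c) (isPinnacleHigh c)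
        (keepHigh k) (keepHigh 0) (λ _ _ → refl)
         (isPinnacle-keepHigh k c 1≤c) (isPinnacle-keepPositive c 1≤c) (framed w) (framed v)
             (collapse-keepHigh-highWord s can)

-- The bijection

<2+-split : (c k : ℕ) → c < suc (suc k) → (c ≤ k) ⊎ (c ≡ suc k)
<2+-split c k (s≤s le) with m≤n⇒m<n∨m≡n le
... | inj₁ (s≤s lt) = inj₁ lt
... | inj₂ e = inj₂ e

≤-or-above : (c k : ℕ) → (c ≤ k) ⊎ Σ ℕ (λ c' → (1 ≤ c') × (c' + k ≡ c))
≤-or-above c k with ≤-<-connex c k
... | inj₁ le = inj₁ le
... | inj₂ lt = inj₂ (c ∸ k , m<n⇒0<n∸m lt , m∸n+n≡m (<⇒≤ lt))

module Count (x₀ : Bool) (B1′ B2 : Block) (i j : ℕ) where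
  B1 : Block
  B1 = x₀ ∷ B1′
  open Concatenation B1 B2
  open Threshold k

  B : Block
  B = B1 ++ B2
  n : ℕ
  n = length B

  k≤n : k ≤ n
  k≤n = subst (k ≤_) (sym length-B) (m≤m+n k m)

  Words : List (List ℕ)
  Words = Admissible B i j

  LowWords : ℕ → List (List ℕ)
  LowWords a = Admissible B1 a j

  HighWords : ℕ → List (List ℕ)
  HighWords a = Admissible B2 i (suc a)

  +k-bound : (c : ℕ) → c < suc (suc m) → c + k < suc (suc n)
  +k-bound c c< = subst (c + k <_)
      (trans (cong suc (trans (+-comm (suc m) k) (+-suc k m)))
      (cong (λ q → suc (suc q)) (sym length-B))) (+-monoˡ-< k c<)

  +k-bound⁻ : (c : ℕ) → c + k < suc (suc n) → c < suc (suc m)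
  +k-bound⁻ c h = +-cancelʳ-< k c (suc (suc m))
      (subst (c + k <_) (trans (cong (λ q → suc (suc q)) length-B)
      (cong suc (sym (trans (+-comm (suc m) k) (+-suc k m))))) h)

  module Forward (h0 : List ℕ) (l h : List ℕ) (ps' : List (List ℕ × List ℕ))
                 (can : Canonical (h0 , (l , h) ∷ ps')) (a : ℕ) (lenps : length ps' ≡ a)
                 (w-valid : Valid B i j (interleave h0 ((l , h) ∷ ps')))
                 (w-bounded : All (_< suc (suc n)) (interleave h0 ((l , h) ∷ ps'))) where
    ps : List (List ℕ × List ℕ)
    ps = (l , h) ∷ ps'
    s : Runs
    s = (h0 , ps)
    u : List ℕ
    u = lowWord s
    v : List ℕ
    v = highWord s
    c : Alternating ps
    c = proj₂ can
    hi : High h0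
    hi = proj₁ can

    lows : List (List ℕ)
    lows = map proj₁ ps

    lows-avoid : All (Avoids (suc k)) lows
    lows-avoid = alternating-lows-avoid ps c

    occ-top-u : occ (suc k) u ≡ a
    occ-top-u = trans (occ-joinWith (suc k) l (map proj₁ ps') lows-avoid) (trans (length-map proj₁ ps') lenps)

    u-bounded : All (_< suc (suc k)) u
    u-bounded = joinWith-All (suc k) lows ≤-refl
        (All.map (λ {l} q → low-bounded l (proj₂ q)) (alternating-lowPieces ps c))

    splitOn-u : splitOn (suc k) u ≡ lows
    splitOn-u with lows-avoid
    ... | nl ∷ nls = splitOn-joinWith (suc k) l (map proj₁ ps') nl nls

    u-noNonPinnacle : countᵇ (isNonPinnacle (suc k)) (windows (framed u)) ≡ 0
    u-noNonPinnacle = pieces-nonEmpty⇒noNonPinnacle (suc k) ∞ u refl (All.map ≤-pred u-bounded)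
        (subst (All NonEmpty) (sym splitOn-u) (alternating-lows-nonEmpty ps c))

    u-valid : Valid B1 a j u
    u-valid = v1 , v2 , v3
      where
      v1 : ∀ c → c < suc (suc k) → occ c u ≡ multArr k a j c
      v1 c c< with <2+-split c k c<
      ... | inj₁ c≤k = trans (sym (occ-lowWord s can c c≤k))
          (trans (proj₁ w-valid c (s≤s (≤-trans c≤k (≤-trans k≤n (n≤1+n n))))) (multArr-low i j a c c≤k))
      ... | inj₂ refl = trans occ-top-u (sym (multArr-top a j))
      v2 : ∀ c → c < suc (suc k) → pinnacleCount c u ≡ multPin B1 a c
      v2 c c< with <2+-split c k c<
      ... | inj₁ c≤k = trans (sym (pinnacles-lowWord s can c c≤k))
          (trans (proj₁ (proj₂ w-valid) c (s≤s (≤-trans c≤k (≤-trans k≤n (n≤1+n n))))) (multPin-low i a c c≤k))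
      ... | inj₂ refl = trans (noNonPinnacle⇒pinnacles≡occ (suc k) u u-noNonPinnacle)
          (trans occ-top-u (sym (multPin-top a)))
      v3 : badZeroCount u ≡ 0
      v3 = trans (sym (badZeros-lowWord s can)) (proj₂ (proj₂ w-valid))

    highs-avoid : All (Avoids 0) (lower h0 ∷ map lowerHigh ps)
    highs-avoid = lower-avoids h0 hi ∷ alternating-highs-avoid ps c

    occ-0-v : occ 0 v ≡ suc a
    occ-0-v = trans (occ-joinWith 0 (lower h0) (map lowerHigh ps) highs-avoid)
        (trans (length-map lowerHigh ps) (cong suc lenps))

    ∸k-bound : (x : ℕ) → x < suc (suc n) → x ∸ k < suc (suc m)
    ∸k-bound x x< = m<n+o⇒m∸n<o x k
        (subst (x <_) (trans (cong (λ q → suc (suc q)) length-B)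
        (sym (trans (+-suc k (suc m)) (cong suc (+-suc k m))))) x<)

    All-lower-bound : (h : List ℕ) → All (_< suc (suc n)) h → All (_< suc (suc m)) (lower h)
    All-lower-bound [] [] = []
    All-lower-bound (x ∷ h) (p ∷ a) = ∸k-bound x p ∷ All-lower-bound h a

    v-bounded : All (_< suc (suc m)) v
    v-bounded with All-interleave⁻ h0 ps w-bounded
    ... | a0 , aps = joinWith-All 0 (lower h0 ∷ map lowerHigh ps) (s≤s z≤n) (All-lower-bound h0 a0 ∷ go ps aps)
      where
      go : (qs : List (List ℕ × List ℕ))
          → All (λ q → All (_< suc (suc n)) (proj₁ q) × All (_< suc (suc n)) (proj₂ q)) qs →
        All (All (_< suc (suc m))) (map lowerHigh qs)
      go [] [] = []
      go (q ∷ qs) ((_ , ah) ∷ as) = All-lower-bound (proj₂ q) ah ∷ go qs as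

    breakOn-v : proj₂ (breakOn 0 v) ≡ map lowerHigh ps
    breakOn-v with highs-avoid
    ... | n0 ∷ ns = ∷-injectiveʳ (splitOn-joinWith 0 (lower h0) (map lowerHigh ps) n0 ns)

    v-valid : Valid B2 i (suc a) v
    v-valid = v1 , v2 , v3
      where
      v1 : ∀ c → c < suc (suc m) → occ c v ≡ multArr m i (suc a) c
      v1 zero _ = occ-0-v
      v1 (suc c) c< = trans (sym (occ-highWord s can (suc c) (s≤s z≤n)))
          (trans (proj₁ w-valid (suc c + k) (+k-bound (suc c) c<)) (multArr-high i j (suc a) (suc c) (s≤s z≤n)))
      v2 : ∀ c → c < suc (suc m) → pinnacleCount c v ≡ multPin B2 i c
      v2 zero _ = trans (no-pinnacle-0 (windows (framed v))) (sym (multPin-zero i))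
      v2 (suc c) c< = trans (sym (pinnacles-highWord s can (suc c) (s≤s z≤n)))
          (trans (proj₁ (proj₂ w-valid) (suc c + k) (+k-bound (suc c) c<)) (multPin-high i (suc c) (s≤s z≤n)))
      v3 : badZeroCount v ≡ 0
      v3 = rest-initNonEmpty⇒noBadZero ∞ v refl
          (subst InitNonEmpty (sym breakOn-v) (alternating-highs-initNonEmpty ps c))

  module Backward (a : ℕ) (u v : List ℕ) (mu : u ∈ LowWords a) (mv : v ∈ HighWords a) where
    u-valid = proj₁ (∈-Admissible⁻ B1 a j u mu)
    u-bounded = proj₂ (∈-Admissible⁻ B1 a j u mu)
    v-valid = proj₁ (∈-Admissible⁻ B2 i (suc a) v mv)
    v-bounded = proj₂ (∈-Admissible⁻ B2 i (suc a) v mv)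

    lows : List (List ℕ)
    lows = splitOn (suc k) u
    firstHigh : List ℕ
    firstHigh = proj₁ (breakOn 0 v)
    restHighs : List (List ℕ)
    restHighs = proj₂ (breakOn 0 v)
    highs : List (List ℕ)
    highs = map raise restHighs
    s : Runs
    s = fromWords u v

    occ-top-u : occ (suc k) u ≡ a
    occ-top-u = trans (proj₁ u-valid (suc k) ≤-refl) (multArr-top a j)

    length-lows : length lows ≡ suc a
    length-lows = cong suc (trans (length-breakOn (suc k) u) occ-top-u)

    length-restHighs : length restHighs ≡ suc a
    length-restHighs = trans (length-breakOn 0 v) (proj₁ v-valid 0 (s≤s z≤n))

    lengths-agree : length lows ≡ length restHighs
    lengths-agree = trans length-lows (sym length-restHighs)

    u-nonEmpty : NonEmpty u
    u-nonEmpty refl with proj₁ u-valid 1 (s≤s (s≤s z≤n))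
    ... | ()

    u-noNonPinnacle : countᵇ (isNonPinnacle (suc k)) (windows (framed u)) ≡ 0
    u-noNonPinnacle = pinnacles≡occ⇒noNonPinnacle (suc k) u
        (trans (proj₁ (proj₂ u-valid) (suc k) ≤-refl) (trans (multPin-top a) (sym occ-top-u)))

    lows-nonEmpty : All NonEmpty lows
    lows-nonEmpty = noNonPinnacle⇒pieces-nonEmpty (suc k) ∞ u refl (All.map ≤-pred u-bounded)
        u-nonEmpty u-noNonPinnacle

    lows-low : All (λ l → NonEmpty l × Low l) lows
    lows-low = zip3 lows lows-nonEmpty (splitOn-All (suc k) u u-bounded) (splitOn-avoids (suc k) u)
      where
      zip3 : (xs : List (List ℕ)) → All NonEmpty xs → All (All (_< suc (suc k))) xs → All (Avoids (suc k)) xs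
          → All (λ l → NonEmpty l × Low l) xs
      zip3 [] [] [] [] = []
      zip3 (x ∷ xs) (a ∷ as) (b ∷ bs) (c ∷ cs) = (a , low-piece x b c) ∷ zip3 xs as bs cs

    v-pieces-avoid : All (Avoids 0) (firstHigh ∷ restHighs)
    v-pieces-avoid = splitOn-avoids 0 v

    highs-high : All High highs
    highs-high = go restHighs (All.tail v-pieces-avoid)
      where
      go : (qs : List (List ℕ)) → All (Avoids 0) qs → All High (map raise qs)
      go [] [] = []
      go (q ∷ qs) (n ∷ ns) = raise-high q n ∷ go qs ns

    highs-initNonEmpty : InitNonEmpty highs
    highs-initNonEmpty = InitNonEmpty-raise restHighs (noBadZero⇒rest-initNonEmpty ∞ v refl (proj₂ (proj₂ v-valid)))

    runs-canonical : Canonical s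
    runs-canonical = raise-high firstHigh (All.head v-pieces-avoid) ,
           zip-alternating⁺ lows highs (trans lengths-agree (sym (length-map raise restHighs))) (λ ()) lows-low
               highs-high highs-initNonEmpty

    runs-length : length (proj₂ s) ≡ suc a
    runs-length = trans (length-zip lows highs (trans lengths-agree (sym (length-map raise restHighs)))) length-lows

    lowWord-runs : lowWord s ≡ u
    lowWord-runs = lowWord-fromWords u v lengths-agree

    highWord-runs : highWord s ≡ v
    highWord-runs = highWord-fromWords u v lengths-agree

    w' : List ℕ
    w' = flatten s

    w-valid : Valid B i j w'
    w-valid = v1 , v2 , v3
      where
      v1 : ∀ c → c < suc (suc n) → occ c w' ≡ multArr n i j c
      v1 c c< with ≤-or-above c k
      ... | inj₁ c≤k = trans (occ-lowWord s runs-canonical c c≤k)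
          (trans (cong (occ c) lowWord-runs)
          (trans (proj₁ u-valid c (s≤s (≤-trans c≤k (n≤1+n k)))) (sym (multArr-low i j a c c≤k))))
      ... | inj₂ (c' , 1≤c' , refl) = trans (occ-highWord s runs-canonical c' 1≤c')
          (trans (cong (occ c') highWord-runs)
          (trans (proj₁ v-valid c' (+k-bound⁻ c' c<)) (sym (multArr-high i j (suc a) c' 1≤c'))))
      v2 : ∀ c → c < suc (suc n) → pinnacleCount c w' ≡ multPin B i c
      v2 c c< with ≤-or-above c k
      ... | inj₁ c≤k = trans (pinnacles-lowWord s runs-canonical c c≤k)
          (trans (cong (pinnacleCount c) lowWord-runs)
          (trans (proj₁ (proj₂ u-valid) c (s≤s (≤-trans c≤k (n≤1+n k)))) (sym (multPin-low i a c c≤k))))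
      ... | inj₂ (c' , 1≤c' , refl) = trans (pinnacles-highWord s runs-canonical c' 1≤c')
          (trans (cong (pinnacleCount c') highWord-runs)
          (trans (proj₁ (proj₂ v-valid) c' (+k-bound⁻ c' c<)) (sym (multPin-high i c' 1≤c'))))
      v3 : badZeroCount w' ≡ 0
      v3 = trans (badZeros-lowWord s runs-canonical) (trans (cong badZeroCount lowWord-runs) (proj₂ (proj₂ u-valid)))

    All-raise-bound : (p : List ℕ) → All (_< suc (suc m)) p → All (_< suc (suc n)) (raise p)
    All-raise-bound [] [] = []
    All-raise-bound (x ∷ p) (b ∷ bs) = +k-bound x b ∷ All-raise-bound p bs

    w-bounded : All (_< suc (suc n)) w'
    w-bounded with splitOn-All {P = _< suc (suc m)} 0 v v-bounded
    ... | b0 ∷ bs = All-interleave⁺ (raise firstHigh) (zip lows highs) (All-raise-bound firstHigh b0)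
        (All-zip lows highs (All.map (λ {l} q → lowN l (proj₂ q)) lows-low) (goH restHighs bs))
      where
      lowN : (l : List ℕ) → Low l → All (_< suc (suc n)) l
      lowN l lo = All.map (λ {x} e → s≤s (≤-trans (<ᵇ-false⁻ {k} {x} e) (≤-trans k≤n (n≤1+n n)))) lo
      goH : (qs : List (List ℕ)) → All (All (_< suc (suc m))) qs → All (All (_< suc (suc n))) (map raise qs)
      goH [] [] = []
      goH (q ∷ qs) (b ∷ bs) = All-raise-bound q b ∷ goH qs bs

    w-∈ : w' ∈ Words
    w-∈ = ∈-Admissible⁺ B i j w' w-valid w-bounded

  occ1-high : (h : List ℕ) → High h → occ 1 h ≡ 0
  occ1-high [] [] = refl
  occ1-high (x ∷ h) (hx ∷ hh) = trans
      (cong (_+ occ 1 h) (cong toℕ (≡ᵇ-false {x} {1}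
      (λ e → <⇒≱ (<ᵇ-true⁻ {k} {x} hx) (subst (_≤ k) (sym e) (s≤s z≤n)))))) (occ1-high h hh)

  forward : (w : List ℕ) → w ∈ Words
      → Σ ℕ (λ a → (length (proj₂ (toRuns w)) ≡ suc a) × Canonical (toRuns w) × (lowWord (toRuns w) ∈ LowWords a)
      × (highWord (toRuns w) ∈ HighWords a))
  forward w mem with ∈-Admissible⁻ B i j w mem
  ... | w-valid , w-bounded with toRuns w | toRuns-canonical w | flatten-toRuns w
  ...   | (h0 , []) | (hi , _) | e = ⊥-elim
      (0≢1+n (trans (sym (occ1-high h0 hi)) (trans (cong (occ 1) e) (proj₁ w-valid 1 (s≤s (s≤s z≤n))))))
  ...   | (h0 , (l , h) ∷ ps') | (hi , inj₁ ()) | e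
  ...   | (h0 , (l , h) ∷ ps') | (hi , inj₂ c) | e =
    length ps' , refl , (hi , c) , ∈-Admissible⁺ B1 (length ps') j FW.u FW.u-valid FW.u-bounded , ∈-Admissible⁺ B2 i
        (suc (length ps')) FW.v FW.v-valid FW.v-bounded
    where
    module FW = Forward h0 l h ps' (hi , c) (length ps') refl (subst (Valid B i j) (sym e) w-valid)
        (subst (All (_< suc (suc n))) (sym e) w-bounded)

  rank : List ℕ → ℕ
  rank w = length (proj₂ (toRuns w)) ∸ 1

  N : ℕ
  N = ones B2 + i + 1

  rank-bound : (a : ℕ) (v : List ℕ) → v ∈ HighWords a → a < N
  rank-bound a v mv = subst (a <_) (sym (+-comm (ones B2 + i) 1))
      (s≤s (≤-pred (subst (suc a ≤_) (cong suc v-peaks) zeros≤peaks)))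
    where
    v-valid = proj₁ (∈-Admissible⁻ B2 i (suc a) v mv)
    v-bounded = proj₂ (∈-Admissible⁻ B2 i (suc a) v mv)
    occ≤1 : ∀ y → 1 ≤ y → y ≢ suc m → occ y v ≤ 1
    occ≤1 y 1≤y ne with y <? suc (suc m)
    ... | no ¬y< = subst (_≤ 1) (sym (occ-out-of-range (suc (suc m)) y v v-bounded (≮⇒≥ ¬y<))) z≤n
    occ≤1 zero () ne | yes y<
    occ≤1 (suc y) _ ne | yes y< = ≤-reflexive
        (trans (proj₁ v-valid (suc y) y<)
        (cong (λ b → if b then i else 1) (≡ᵇ-false {y} {m} (λ e → ne (cong suc e)))))
    v-noRepeat : NoAdjacentRepeat v
    v-noRepeat = noAdjacentRepeat (suc m) ∞ v (proj₂ (proj₂ v-valid))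
            (pinnacles≡occ⇒noNonPinnacle (suc m) v
                (trans (proj₁ (proj₂ v-valid) (suc m) ≤-refl)
                (trans (multPin-top-v) (sym (trans (proj₁ v-valid (suc m) ≤-refl) multArr-top-v)))))
            occ≤1
      where
      multPin-top-v : multPin B2 i (suc m) ≡ i
      multPin-top-v rewrite ≡ᵇ-true {m} {m} refl = refl
      multArr-top-v : multArr m i (suc a) (suc m) ≡ i
      multArr-top-v rewrite ≡ᵇ-true {m} {m} refl = refl
    v-peaks : countᵇ isPeak (windows (framed v)) ≡ ones B2 + i
    v-peaks = trans (peaks≡sumBelow-pinnacles (suc (suc m)) (windows (framed v))
        (windows-middleBelow (suc (suc m)) ∞ v v-bounded))
                (trans (sumBelow-cong (suc (suc m)) _ _ (proj₁ (proj₂ v-valid))) (sumBelow-multPin B2 i))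
    zeros≤peaks : suc a ≤ suc (countᵇ isPeak (windows (framed v)))
    zeros≤peaks = subst (_≤ suc (countᵇ isPeak (windows (framed v)))) (proj₁ v-valid 0 (s≤s z≤n))
        (occ0≤1+peaks v v-noRepeat)

  rank<N : (w : List ℕ) → w ∈ Words → rank w < N
  rank<N w mem with forward w mem
  ... | a , len , can , uY , vZ = subst (_< N) (sym (cong (_∸ 1) len)) (rank-bound a (highWord (toRuns w)) vZ)

  WordsOfRank : ℕ → List (List ℕ)
  WordsOfRank a = filter (λ w → T? (rank w ≡ᵇ a)) Words

  split : List ℕ → List ℕ × List ℕ
  split w = (lowWord (toRuns w) , highWord (toRuns w))

  merge : List ℕ × List ℕ → List ℕ
  merge y = flatten (fromWords (proj₁ y) (proj₂ y))

  count-rank : (a : ℕ) → length (WordsOfRank a) ≡ length (LowWords a) * length (HighWords a)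
  count-rank a = trans (length-≡-bijection split merge (WordsOfRank a) (cartesianProduct (LowWords a) (HighWords a))
      (UP.filter⁺ (λ w → T? (rank w ≡ᵇ a)) (Admissible-unique B i j))
      (UP.cartesianProduct⁺ (Admissible-unique B1 a j) (Admissible-unique B2 i (suc a)))
      split-∈ merge-split merge-∈ split-merge) (length-cartesianProduct (LowWords a) (HighWords a))
    where
    split-∈ : ∀ {x} → x ∈ WordsOfRank a → split x ∈ cartesianProduct (LowWords a) (HighWords a)
    split-∈ {x} mem with ∈-filter⁻ (λ w → T? (rank w ≡ᵇ a)) {xs = Words} mem
    ... | xX , t with forward x xX
    ...   | a' , len , can , uY , vZ with ≡ᵇ⇒≡ (rank x) a t
    ...     | ra rewrite len | ra = ∈-cartesianProduct⁺ uY vZ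
    merge-split : ∀ {x} → x ∈ WordsOfRank a → merge (split x) ≡ x
    merge-split {x} mem with ∈-filter⁻ (λ w → T? (rank w ≡ᵇ a)) {xs = Words} mem
    ... | xX , t with forward x xX
    ...   | a' , len , can , uY , vZ = trans
        (cong flatten (fromWords-lowWord-highWord (toRuns x) can)) (flatten-toRuns x)
    merge-∈ : ∀ {y} → y ∈ cartesianProduct (LowWords a) (HighWords a) → merge y ∈ WordsOfRank a
    merge-∈ {y} mem with ∈-cartesianProduct⁻ (LowWords a) (HighWords a) mem
    ... | mu , mv = ∈-filter⁺ (λ w → T? (rank w ≡ᵇ a)) BW.w-∈
          (≡⇒≡ᵇ (rank BW.w') a (trans (cong (λ s → length (proj₂ s) ∸ 1)
              (toRuns-interleave _ _ (proj₁ BW.runs-canonical , inj₂ (proj₂ BW.runs-canonical))))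
              (cong (_∸ 1) BW.runs-length)))
      where module BW = Backward a (proj₁ y) (proj₂ y) mu mv
    split-merge : ∀ {y} → y ∈ cartesianProduct (LowWords a) (HighWords a) → split (merge y) ≡ y
    split-merge {y} mem with ∈-cartesianProduct⁻ (LowWords a) (HighWords a) mem
    ... | mu , mv = trans (cong (λ s → (lowWord s , highWord s))
        (toRuns-interleave _ _ (proj₁ BW.runs-canonical , inj₂ (proj₂ BW.runs-canonical))))
        (cong₂ _,_ BW.lowWord-runs BW.highWord-runs)
      where module BW = Backward a (proj₁ y) (proj₂ y) mu mv

  p-concatenation : p B i j ≡ sumFrom1 N (λ a → p B1 (a ∸ 1) j * p B2 i a)
  p-concatenation = begin
    length Words ≡⟨ length≡sumBelow-countᵇ rank N Words (All.tabulate (λ {w} → rank<N w)) ⟩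
    sumBelow N (λ a → countᵇ (λ w → rank w ≡ᵇ a) Words)
        ≡⟨ sumBelow-cong N _ _ (λ a _ → trans
        (sym (length-filter≡countᵇ (λ w → T? (rank w ≡ᵇ a)) Words)) (count-rank a)) ⟩
    sumBelow N (λ a → length (LowWords a) * length (HighWords a))
        ≡⟨ sym (sum-map-applyUpTo (λ a → p B1 (a ∸ 1) j * p B2 i a) suc N) ⟩
    sumFrom1 N (λ a → p B1 (a ∸ 1) j * p B2 i a) ∎
    where open ≡-Reasoning

mainTheorem8 : (B₁ B₂ : Block) → B₁ ≢ [] → B₂ ≢ [] → (i j : ℕ) →
    p (B₁ ++ B₂) i j ≡ sumFrom1 (ones B₂ + i + 1) (λ a → p B₁ (a ∸ 1) j * p B₂ i a)
mainTheorem8 [] B₂ B₁≢[] _ i j = ⊥-elim (B₁≢[] refl)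
mainTheorem8 (x ∷ B₁) B₂ _ _ i j = Count.p-concatenation x B₁ B₂ i j
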